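{- Let $\mathcal I$ be any Tambara ideal of the Burnside Tambara functor $\underline A_{C_N}$. Let $K\mid M\mid N$ with $4\mid K$, and suppose $t_4-t_2-2\in\mathcal I(C_N/C_K)$. Let $2^j$ be the largest power of $2$ dividing $M/K$. Then: - for all $1\le i\le j+2$, we have $t_{2^i}+t_2-(2^i+2)\in\mathcal I(C_N/C_M)$; - furthermore, $2t_2-4\in\mathcal I(C_N/C_{K/2})$.
   Context: $C_N$ denotes the cyclic group of order $N$, and $C_M$ its unique subgroup of order $M$. The Burnside Tambara functor $\underline A_{C_N}$ has level $\underline A_{C_N}(C_N/C_M)=A(C_M)$, the Burnside ring of $C_M$. Its structure maps are: restriction of action; transfer $X\mapsto C_M\times_{C_L}X$; and norm $X\mapsto\mathrm{Map}_{C_L}(C_M,X)$. A Tambara ideal $\mathcal I$ is a family of ring ideals $\mathcal I(C_N/C_M)\subseteq A(C_M)$ satisfying the following for $L\mid M$: - it is closed under restriction; - it is closed under transfer; - $N_L^M(\mathcal I(C_N/C_L))\subseteq \mathcal I(C_N/C_M)+N_L^M(0)$. For $K\mid M$ with $k=M/K$, the symbol $t_k=t_{M,k}$ denotes the class of $C_M/C_K$ in $A(C_M)$. An integer $n$ stands for $n\,t_{M,1}$, and $t_{M,1}$ is the unit. -}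

module Defs where

open import Data.Nat as ℕ using (ℕ; zero; suc)
open import Data.Nat.Divisibility using (_∣_; _∣?_)
open import Data.Nat.GCD using (gcd)
open import Data.Nat.LCM using (lcm)
open import Data.Integer as ℤ using (ℤ; +_)
open import Data.List using (List; filter; map; upTo; foldr)
open import Data.Bool using (if_then_else_)
open import Data.Product using (Σ; _×_)
open import Relation.Nullary using (does)
open import Relation.Binary.PropositionalEquality using (_≡_)

-- Natural-number division, total (x div 0 = 0); only ever used with
-- nonzero divisors in the intended situations.

_div_ : ℕ → ℕ → ℕ
m div zero    = 0
m div (suc n) = m ℕ./ suc n

divisors : ℕ → List ℕ
divisors M = filter (λ d → d ∣? M) (map suc (upTo M))

Σdiv : ℕ → (ℕ → ℤ) → ℤ
Σdiv M f = foldr ℤ._+_ (+ 0) (map f (divisors M))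

-- Burnside ring A(C_M) in the basis of transitive C_M-sets:
-- x : Bur represents  Σ_{K ∣ M} (x K) · [C_M / C_K].
-- Values at non-divisors K are irrelevant; equality in A(C_M) is ≈[ M ].

Bur : Set
Bur = ℕ → ℤ

_≈[_]_ : Bur → ℕ → Bur → Set
x ≈[ M ] y = ∀ K → K ∣ M → x K ≡ y K

0B : Bur
0B _ = + 0

_+B_ : Bur → Bur → Bur
(x +B y) J = x J ℤ.+ y J

-B_ : Bur → Bur
(-B x) J = ℤ.- (x J)

_-B_ : Bur → Bur → Bur
x -B y = x +B (-B y)

_·B_ : ℤ → Bur → Bur
(n ·B x) J = n ℤ.* x J

-- t_{M,k} = [C_M / C_K] with K = M / k
t : ℕ → ℕ → Bur
t M k J = if does (J ℕ.≟ (M div k)) then + 1 else + 0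

-- the integer n, i.e. n · t_{M,1}  (t_{M,1} = [C_M/C_M] is the unit)
ι : ℕ → ℤ → Bur
ι M n = n ·B t M 1

-- product in A(C_M):
-- [C_M/C_K] × [C_M/C_K'] = (M·g/(K·K')) · [C_M/C_g],  g = gcd K K'
mulB : ℕ → Bur → Bur → Bur
mulB M x y J =
  Σdiv M λ K → Σdiv M λ K' →
    if does (gcd K K' ℕ.≟ J)
    then x K ℤ.* y K' ℤ.* + ((M ℕ.* gcd K K') div (K ℕ.* K'))
    else + 0

-- restriction A(C_M) → A(C_L), L ∣ M:
-- res [C_M/C_K] = (M·g/(K·L)) · [C_L/C_g],  g = gcd K L
res : ℕ → ℕ → Bur → Bur
res M L x J =
  Σdiv M λ K →
    if does (gcd K L ℕ.≟ J)
    then x K ℤ.* + ((M ℕ.* gcd K L) div (K ℕ.* L))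
    else + 0

-- transfer A(C_L) → A(C_M), L ∣ M:  C_M ×_{C_L} C_L/C_J = C_M/C_J
tr : ℕ → Bur → Bur
tr L x J = if does (J ∣? L) then x J else + 0

-- table of marks: marks M x D = |x^{C_D}|  (D ∣ M);
-- |(C_M/C_K)^{C_D}| = M/K if D ∣ K, else 0
marks : ℕ → Bur → ℕ → ℤ
marks M x D = Σdiv M λ K → if does (D ∣? K) then + (M div K) ℤ.* x K else + 0

-- The norm
-- X ↦ Map_{C_L}(C_M, X) (extended polynomially to virtual sets) is
-- characterised by its marks, since the mark homomorphism is injective:
-- |Map_{C_L}(C_M,X)^{C_D}| = |X^{C_{L∩D}}|^{[C_M : C_L C_D]}.
IsNorm : ℕ → ℕ → Bur → Bur → Set
IsNorm L M x y =
  ∀ D → D ∣ M → marks M y D ≡ (marks L x (gcd L D)) ℤ.^ (M div lcm L D)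

record IsIdeal (M : ℕ) (P : Bur → Set) : Set where
  field
    resp   : ∀ {x y} → x ≈[ M ] y → P x → P y
    has0   : P 0B
    +-cl   : ∀ {x y} → P x → P y → P (x +B y)
    neg-cl : ∀ {x} → P x → P (-B x)
    mul-cl : ∀ r {x} → P x → P (mulB M r x)

-- Tambara ideals of the Burnside Tambara functor A_{C_N};
-- I M is the ideal I(C_N/C_M) ⊆ A(C_M), for M ∣ N.
record IsTambaraIdeal (N : ℕ) (I : ℕ → Bur → Set) : Set where
  field
    ideal   : ∀ M → M ∣ N → IsIdeal M (I M)
    res-cl  : ∀ L M → L ∣ M → M ∣ N → ∀ {x} → I M x → I L (res M L x)
    tr-cl   : ∀ L M → L ∣ M → M ∣ N → ∀ {x} → I L x → I M (tr L x)
    norm-cl : ∀ L M → L ∣ M → M ∣ N → ∀ {x y z} → I L x →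
              IsNorm L M x y → IsNorm L M 0B z →
              Σ Bur (λ w → I M w × (y ≈[ M ] (w +B z)))

-- Write X, Y and Z i for t₄ - t₂ - 2, 2t₂ - 4 and t_{2^i} + t₂ - (2^i + 2). By the norm axiom, T lies
-- in I(qL) as soon as T - R has the marks of N_L^{qL}(x) for some x ∈ I(L) and R ∈ I(qL); for a prime
-- q these marks are x(D)^q at the subgroups C_D ≤ C_L and x(D/q) at the others. A finite computation
-- with the marks of X and Y shows that X_{2L} - N(X_L), Y_{2L} - N(Y_L) and, for an odd prime p,
-- X_{pL} - N(X_L) are transfers of elements of I(L); in the last case the coefficients are integers
-- by Fermat's little theorem. So X lies in I at every level between K and M; restricting X gives Y
-- at half the level, and doubling brings Y back up. Finally Z₁ = Y, Z₂ = X + Y, and Z_{i+1} at level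
-- 2L is tr(Z_i) - X + (2^{i-1} + 1) Y, which gives Z_i at level M as long as 2^{i-2} divides M/K.

{-# OPTIONS --safe #-}
module Submission where

open import Defs

open import Data.Bool using (true; false; if_then_else_)
open import Data.Empty using (⊥-elim)
open import Data.Integer as ℤ using (ℤ; +_; -[1+_])
import Data.Integer.Properties as ℤₚ
open import Data.Integer.Tactic.RingSolver using (solve-∀)
open import Data.List using (List; []; _∷_; map; upTo; foldr)
open import Data.List.Membership.Propositional using (_∈_)
open import Data.List.Membership.Propositional.Properties
  using (∈-filter⁺; ∈-filter⁻; ∈-map⁺; ∈-upTo⁺)
open import Data.List.Relation.Unary.All using (All; []; _∷_)
import Data.List.Relation.Unary.All as All
open import Data.List.Relation.Unary.AllPairs using (_∷_)
open import Data.List.Relation.Unary.Any using (here; there)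
open import Data.List.Relation.Unary.Unique.Propositional using (Unique)
import Data.List.Relation.Unary.Unique.Propositional.Properties as Unique
open import Data.Nat as ℕ using (ℕ; zero; suc; _+_; _*_; _^_; _≤_; _<_; s≤s; z≤n)
import Data.Nat.Properties as ℕₚ
import Data.Nat.Tactic.RingSolver as ℕ-Solver
open import Algebra.Properties.CommutativeSemigroup ℕₚ.*-commutativeSemigroup
  using (x∙yz≈y∙xz; x∙yz≈yx∙z)
import Algebra.Properties.CommutativeSemigroup ℕₚ.+-commutativeSemigroup as ℕ+
import Algebra.Properties.CommutativeSemigroup ℤₚ.+-commutativeSemigroup as ℤ+
open import Data.Nat.Combinatorics using (_C_; nC1≡n; nCn≡1; k>n⇒nCk≡0; nCk+nC[k+1]≡[n+1]C[k+1])
open import Data.Nat.Coprimality using (Coprime; coprime-factors)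
open import Data.Nat.Divisibility
open import Data.Nat.DivMod using (m*n/n≡m)
open import Data.Nat.GCD using (gcd; gcd[m,n]∣m; gcd[m,n]∣n; gcd-greatest; gcd-comm)
open import Data.Nat.LCM using (lcm; m∣lcm[m,n]; n∣lcm[m,n]; lcm-least; gcd*lcm)
open import Data.Nat.ListAction using (product)
open import Data.Nat.Primality
  using (Prime; prime[2]; ¬prime[1]; euclidsLemma; prime⇒irreducible; prime⇒nonZero)
open import Data.Nat.Primality.Factorisation using (PrimeFactorisation; factorise)
open import Data.Product using (∃-syntax; _×_; _,_; proj₁; proj₂)
open import Data.Sum using (inj₁; inj₂)
open import Relation.Nullary using (¬_; Dec; yes; no; does)
open import Relation.Binary.PropositionalEquality hiding (resp)

m*n>0⇒n>0 : ∀ m {n} → 0 < m * n → 0 < n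
m*n>0⇒n>0 zero    ()
m*n>0⇒n>0 (suc m) {zero}  m*0>0 = m*n>0⇒n>0 m m*0>0
m*n>0⇒n>0 (suc m) {suc n} _     = s≤s z≤n

m*n>0⇒m>0 : ∀ {m} n → 0 < m * n → 0 < m
m*n>0⇒m>0 {m} n m*n>0 = m*n>0⇒n>0 n (subst (0 <_) (ℕₚ.*-comm m n) m*n>0)

*-positive : ∀ {m n} → 0 < m → 0 < n → 0 < m * n
*-positive {suc m} {suc n} _ _ = s≤s z≤n

∣-positive : ∀ {d n} → d ∣ n → 0 < n → 0 < d
∣-positive {zero}  d∣n n>0 = ⊥-elim (ℕₚ.<⇒≢ n>0 (sym (0∣⇒≡0 d∣n)))
∣-positive {suc d} _   _   = s≤s z≤n

prime>0 : ∀ {p} → Prime p → 0 < p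
prime>0 {p} p-prime = ℕ.>-nonZero⁻¹ p ⦃ prime⇒nonZero p-prime ⦄

exact-div : ∀ {M m k} → M ≡ m * k → 0 < k → M div k ≡ m
exact-div {m = m} {k = suc k} refl _ = m*n/n≡m m (suc k)

^-monoʳ-∣ : ∀ m {n j} → n ≤ j → m ^ n ∣ m ^ j
^-monoʳ-∣ m {n} {j} n≤j with ℕₚ.m≤n⇒∃[o]m+o≡n n≤j
... | o , n+o≡j = divides (m ^ o) (begin
  m ^ j          ≡⟨ cong (m ^_) n+o≡j ⟨
  m ^ (n + o)    ≡⟨ ℕₚ.^-distribˡ-+-* m n o ⟩
  m ^ n * m ^ o  ≡⟨ ℕₚ.*-comm (m ^ n) (m ^ o) ⟩
  m ^ o * m ^ n  ∎)
  where open ≡-Reasoning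

d∣n/m⇒m*d∣n : ∀ {m n d} → m ∣ n → 0 < n → d ∣ n div m → m * d ∣ n
d∣n/m⇒m*d∣n {m} {n} {d} (divides a n≡a*m) n>0 (divides b n/m≡b*d) = divides b (begin
  n            ≡⟨ n≡a*m ⟩
  a * m        ≡⟨ cong (_* m) (trans (sym n/m≡a) n/m≡b*d) ⟩
  b * d * m    ≡⟨ ℕₚ.*-assoc b d m ⟩
  b * (d * m)  ≡⟨ cong (b *_) (ℕₚ.*-comm d m) ⟩
  b * (m * d)  ∎)
  where
  open ≡-Reasoning
  n/m≡a : n div m ≡ a
  n/m≡a = exact-div n≡a*m (m*n>0⇒n>0 a (subst (0 <_) n≡a*m n>0))

n∣m⇒gcd[m,n]≡n : ∀ {D L} → D ∣ L → gcd L D ≡ D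
n∣m⇒gcd[m,n]≡n {D} {L} D∣L = ∣-antisym (gcd[m,n]∣n L D) (gcd-greatest D∣L ∣-refl)

n∣m⇒lcm[m,n]≡m : ∀ {D L} → D ∣ L → lcm L D ≡ L
n∣m⇒lcm[m,n]≡m {D} {L} D∣L = ∣-antisym (lcm-least ∣-refl D∣L) (m∣lcm[m,n] L D)

sumMap : List ℕ → (ℕ → ℤ) → ℤ
sumMap xs f = foldr ℤ._+_ (+ 0) (map f xs)

sumMap-cong : ∀ xs {f g : ℕ → ℤ} → (∀ x → x ∈ xs → f x ≡ g x) → sumMap xs f ≡ sumMap xs g
sumMap-cong []       f≡g = refl
sumMap-cong (x ∷ xs) f≡g =
  cong₂ ℤ._+_ (f≡g x (here refl)) (sumMap-cong xs (λ y y∈ → f≡g y (there y∈)))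

sumMap-+ : ∀ xs (f g : ℕ → ℤ) → sumMap xs (λ x → f x ℤ.+ g x) ≡ sumMap xs f ℤ.+ sumMap xs g
sumMap-+ []       f g = refl
sumMap-+ (x ∷ xs) f g = begin
  (f x ℤ.+ g x) ℤ.+ sumMap xs (λ y → f y ℤ.+ g y)  ≡⟨ cong (ℤ._+_ (f x ℤ.+ g x)) (sumMap-+ xs f g) ⟩
  (f x ℤ.+ g x) ℤ.+ (sumMap xs f ℤ.+ sumMap xs g)  ≡⟨ ℤ+.interchange (f x) (g x) _ _ ⟩
  (f x ℤ.+ sumMap xs f) ℤ.+ (g x ℤ.+ sumMap xs g)  ∎
  where open ≡-Reasoning

sumMap-* : ∀ xs n (f : ℕ → ℤ) → sumMap xs (λ x → n ℤ.* f x) ≡ n ℤ.* sumMap xs f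
sumMap-* []       n f = sym (ℤₚ.*-zeroʳ n)
sumMap-* (x ∷ xs) n f =
  trans (cong (ℤ._+_ (n ℤ.* f x)) (sumMap-* xs n f)) (sym (ℤₚ.*-distribˡ-+ n (f x) (sumMap xs f)))

sumMap-zero : ∀ xs (f : ℕ → ℤ) → (∀ x → x ∈ xs → f x ≡ + 0) → sumMap xs f ≡ + 0
sumMap-zero []       f f≡0 = refl
sumMap-zero (x ∷ xs) f f≡0 =
  cong₂ ℤ._+_ (f≡0 x (here refl)) (sumMap-zero xs f (λ y y∈ → f≡0 y (there y∈)))

sumMap-single : ∀ {xs} (f : ℕ → ℤ) {x₀} → Unique xs → x₀ ∈ xs →
                (∀ x → x ∈ xs → x ≢ x₀ → f x ≡ + 0) → sumMap xs f ≡ f x₀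
sumMap-single {x ∷ xs} f (x∉xs ∷ _) (here refl) f≡0 =
  trans (cong (ℤ._+_ (f x)) (sumMap-zero xs f rest≡0)) (ℤₚ.+-identityʳ (f x))
  where
  rest≡0 : ∀ y → y ∈ xs → f y ≡ + 0
  rest≡0 y y∈ = f≡0 y (there y∈) (λ { refl → All.lookup x∉xs y∈ refl })
sumMap-single {x ∷ xs} f (x∉xs ∷ xs!) (there x₀∈) f≡0 =
  trans (cong (λ s → s ℤ.+ sumMap xs f) (f≡0 x (here refl) (λ { refl → All.lookup x∉xs x₀∈ refl })))
        (trans (ℤₚ.+-identityˡ _) (sumMap-single f xs! x₀∈ (λ y y∈ → f≡0 y (there y∈))))

divisors-unique : ∀ M → Unique (divisors M)
divisors-unique M = Unique.filter⁺ (_∣? M) (Unique.map⁺ ℕₚ.suc-injective (Unique.upTo⁺ M))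

∈divisors⇒∣ : ∀ {M K} → K ∈ divisors M → K ∣ M
∈divisors⇒∣ {M} K∈ = proj₂ (∈-filter⁻ (_∣? M) {xs = map suc (upTo M)} K∈)

∣⇒∈divisors : ∀ {M K} → 0 < M → K ∣ M → K ∈ divisors M
∣⇒∈divisors {suc M} {zero}  _ 0∣M = ⊥-elim (ℕₚ.0≢1+n (sym (0∣⇒≡0 0∣M)))
∣⇒∈divisors {suc M} {suc K} _ K∣M =
  ∈-filter⁺ (_∣? suc M) (∈-map⁺ suc (∈-upTo⁺ (∣⇒≤ K∣M))) K∣M

Σdiv-cong : ∀ M {f g : ℕ → ℤ} → (∀ K → K ∣ M → f K ≡ g K) → Σdiv M f ≡ Σdiv M g
Σdiv-cong M f≡g = sumMap-cong (divisors M) (λ K K∈ → f≡g K (∈divisors⇒∣ K∈))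

Σdiv-zero : ∀ M (f : ℕ → ℤ) → (∀ K → K ∣ M → f K ≡ + 0) → Σdiv M f ≡ + 0
Σdiv-zero M f f≡0 = sumMap-zero (divisors M) f (λ K K∈ → f≡0 K (∈divisors⇒∣ K∈))

Σdiv-single : ∀ M (f : ℕ → ℤ) {K₀} → 0 < M → K₀ ∣ M →
              (∀ K → K ∣ M → K ≢ K₀ → f K ≡ + 0) → Σdiv M f ≡ f K₀
Σdiv-single M f M>0 K₀∣M f≡0 =
  sumMap-single f (divisors-unique M) (∣⇒∈divisors M>0 K₀∣M) (λ K K∈ → f≡0 K (∈divisors⇒∣ K∈))

-- Linear functionals on the Burnside ring

χ : ∀ {P : Set} → Dec P → ℤ
χ d = if does d then + 1 else + 0

χ-cong : ∀ {P Q : Set} (d : Dec P) (e : Dec Q) → (P → Q) → (Q → P) → χ d ≡ χ e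
χ-cong (yes _) (yes _) _   _   = refl
χ-cong (no _)  (no _)  _   _   = refl
χ-cong (yes p) (no ¬q) p⇒q _   = ⊥-elim (¬q (p⇒q p))
χ-cong (no ¬p) (yes q) _   q⇒p = ⊥-elim (¬p (q⇒p q))

if-yes : ∀ {P : Set} {u v : ℤ} (d : Dec P) → P → (if does d then u else v) ≡ u
if-yes (yes _) _ = refl
if-yes (no ¬p) p = ⊥-elim (¬p p)

if-no : ∀ {P : Set} {u v : ℤ} (d : Dec P) → ¬ P → (if does d then u else v) ≡ v
if-no (yes p) ¬p = ⊥-elim (¬p p)
if-no (no _)  _  = refl

record IsLinear (φ : Bur → ℤ) : Set where
  field
    cong-pointwise : ∀ {x y} → (∀ J → x J ≡ y J) → φ x ≡ φ y
    +-hom          : ∀ x y → φ (x +B y) ≡ φ x ℤ.+ φ y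
    ·-hom          : ∀ n x → φ (n ·B x) ≡ n ℤ.* φ x

  zero-hom : φ 0B ≡ + 0
  zero-hom = trans (cong-pointwise (λ _ → refl)) (·-hom (+ 0) 0B)

  neg-hom : ∀ x → φ (-B x) ≡ ℤ.- φ x
  neg-hom x = begin
    φ (-B x)          ≡⟨ cong-pointwise (λ J → sym (ℤₚ.-1*i≡-i (x J))) ⟩
    φ (ℤ.-1ℤ ·B x)    ≡⟨ ·-hom ℤ.-1ℤ x ⟩
    ℤ.-1ℤ ℤ.* φ x     ≡⟨ ℤₚ.-1*i≡-i (φ x) ⟩
    ℤ.- φ x           ∎
    where open ≡-Reasoning

  sub-hom : ∀ x y → φ (x -B y) ≡ φ x ℤ.- φ y
  sub-hom x y = trans (+-hom x (-B y)) (cong (ℤ._+_ (φ x)) (neg-hom y))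

open IsLinear

evaluation-linear : ∀ J → IsLinear (λ x → x J)
evaluation-linear J = record
  { cong-pointwise = λ x≡y → x≡y J
  ; +-hom          = λ _ _ → refl
  ; ·-hom          = λ _ _ → refl
  }

scaleˡ-linear : ∀ {φ} a → IsLinear φ → IsLinear (λ x → a ℤ.* φ x)
scaleˡ-linear {φ} a φ-lin = record
  { cong-pointwise = λ x≡y → cong (a ℤ.*_) (cong-pointwise φ-lin x≡y)
  ; +-hom          = λ x y → trans (cong (a ℤ.*_) (+-hom φ-lin x y)) (ℤₚ.*-distribˡ-+ a (φ x) (φ y))
  ; ·-hom          = λ n x → trans (cong (a ℤ.*_) (·-hom φ-lin n x)) (swap a n (φ x))
  }
  where
  swap : ∀ a n u → a ℤ.* (n ℤ.* u) ≡ n ℤ.* (a ℤ.* u)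
  swap = solve-∀

scaleʳ-linear : ∀ {φ} a → IsLinear φ → IsLinear (λ x → φ x ℤ.* a)
scaleʳ-linear {φ} a φ-lin = record
  { cong-pointwise = λ x≡y → cong (ℤ._* a) (cong-pointwise φ-lin x≡y)
  ; +-hom          = λ x y → trans (cong (ℤ._* a) (+-hom φ-lin x y)) (ℤₚ.*-distribʳ-+ a (φ x) (φ y))
  ; ·-hom          = λ n x → trans (cong (ℤ._* a) (·-hom φ-lin n x)) (ℤₚ.*-assoc n (φ x) a)
  }

guard-linear : ∀ {φ} b → IsLinear φ → IsLinear (λ x → if b then φ x else + 0)
guard-linear true  φ-lin = φ-lin
guard-linear false φ-lin = record
  { cong-pointwise = λ _ → refl
  ; +-hom          = λ _ _ → refl
  ; ·-hom          = λ n _ → sym (ℤₚ.*-zeroʳ n)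
  }

Σdiv-linear : ∀ M {F : Bur → ℕ → ℤ} → (∀ K → IsLinear (λ x → F x K)) →
              IsLinear (λ x → Σdiv M (F x))
Σdiv-linear M F-lin = record
  { cong-pointwise = λ x≡y → Σdiv-cong M (λ K _ → cong-pointwise (F-lin K) x≡y)
  ; +-hom          = λ x y → trans (Σdiv-cong M (λ K _ → +-hom (F-lin K) x y)) (sumMap-+ (divisors M) _ _)
  ; ·-hom          = λ n x → trans (Σdiv-cong M (λ K _ → ·-hom (F-lin K) n x)) (sumMap-* (divisors M) n _)
  }

marks-linear : ∀ M D → IsLinear (λ x → marks M x D)
marks-linear M D =
  Σdiv-linear M (λ K → guard-linear (does (D ∣? K)) (scaleˡ-linear (+ (M div K)) (evaluation-linear K)))

marks-tr-linear : ∀ M L D → IsLinear (λ x → marks M (tr L x) D)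
marks-tr-linear M L D =
  Σdiv-linear M (λ K → guard-linear (does (D ∣? K))
                         (scaleˡ-linear (+ (M div K)) (guard-linear (does (K ∣? L)) (evaluation-linear K))))

tr-linear : ∀ L J → IsLinear (λ x → tr L x J)
tr-linear L J = guard-linear (does (J ∣? L)) (evaluation-linear J)

res-linear : ∀ M L J → IsLinear (λ x → res M L x J)
res-linear M L J =
  Σdiv-linear M (λ K → guard-linear (does (gcd K L ℕ.≟ J))
                         (scaleʳ-linear (+ ((M * gcd K L) div (K * L))) (evaluation-linear K)))

X : ℕ → Bur
X L = (t L 4 -B t L 2) -B ι L (+ 2)

Y : ℕ → Bur
Y L = ((+ 2) ·B t L 2) -B ι L (+ 4)

Z : ℕ → ℕ → Bur
Z L i = (t L (2 ^ i) +B t L 2) -B ι L (+ (2 ^ i + 2))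

module _ {φ : Bur → ℤ} (φ-lin : IsLinear φ) where

  X-expand : ∀ L → φ (X L) ≡ (φ (t L 4) ℤ.- φ (t L 2)) ℤ.- + 2 ℤ.* φ (t L 1)
  X-expand L = trans (sub-hom φ-lin _ _) (cong₂ ℤ._-_ (sub-hom φ-lin _ _) (·-hom φ-lin (+ 2) (t L 1)))

  Y-expand : ∀ L → φ (Y L) ≡ + 2 ℤ.* φ (t L 2) ℤ.- + 4 ℤ.* φ (t L 1)
  Y-expand L =
    trans (sub-hom φ-lin _ _) (cong₂ ℤ._-_ (·-hom φ-lin (+ 2) (t L 2)) (·-hom φ-lin (+ 4) (t L 1)))

  Z-expand : ∀ L i → φ (Z L i) ≡ (φ (t L (2 ^ i)) ℤ.+ φ (t L 2)) ℤ.- + (2 ^ i + 2) ℤ.* φ (t L 1)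
  Z-expand L i =
    trans (sub-hom φ-lin _ _) (cong₂ ℤ._-_ (+-hom φ-lin _ _) (·-hom φ-lin (+ (2 ^ i + 2)) (t L 1)))

module _ {φ ψ : Bur → ℤ} (φ-lin : IsLinear φ) (ψ-lin : IsLinear ψ) {L L′ : ℕ} where

  X-agree : (∀ {k} → k ∣ 4 → φ (t L k) ≡ ψ (t L′ k)) → φ (X L) ≡ ψ (X L′)
  X-agree φ≡ψ = begin
    φ (X L)
      ≡⟨ X-expand φ-lin L ⟩
    (φ (t L 4) ℤ.- φ (t L 2)) ℤ.- + 2 ℤ.* φ (t L 1)
      ≡⟨ cong₂ ℤ._-_ (cong₂ ℤ._-_ (φ≡ψ ∣-refl) (φ≡ψ (divides 2 refl)))
                     (cong (+ 2 ℤ.*_) (φ≡ψ (1∣ 4))) ⟩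
    (ψ (t L′ 4) ℤ.- ψ (t L′ 2)) ℤ.- + 2 ℤ.* ψ (t L′ 1)
      ≡⟨ X-expand ψ-lin L′ ⟨
    ψ (X L′) ∎
    where open ≡-Reasoning

  Y-agree : (∀ {k} → k ∣ 2 → φ (t L k) ≡ ψ (t L′ k)) → φ (Y L) ≡ ψ (Y L′)
  Y-agree φ≡ψ = begin
    φ (Y L)
      ≡⟨ Y-expand φ-lin L ⟩
    + 2 ℤ.* φ (t L 2) ℤ.- + 4 ℤ.* φ (t L 1)
      ≡⟨ cong₂ ℤ._-_ (cong (+ 2 ℤ.*_) (φ≡ψ ∣-refl)) (cong (+ 4 ℤ.*_) (φ≡ψ (1∣ 2))) ⟩
    + 2 ℤ.* ψ (t L′ 2) ℤ.- + 4 ℤ.* ψ (t L′ 1)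
      ≡⟨ Y-expand ψ-lin L′ ⟨
    ψ (Y L′) ∎
    where open ≡-Reasoning

t-at : ∀ {M k m} → M div k ≡ m → t M k m ≡ + 1
t-at {m = m} M/k≡m = if-yes (m ℕ.≟ _) (sym M/k≡m)

t-off : ∀ {M k m K} → M div k ≡ m → K ≢ m → t M k K ≡ + 0
t-off {K = K} M/k≡m K≢m = if-no (K ℕ.≟ _) (λ K≡M/k → K≢m (trans K≡M/k M/k≡m))

tr-∣ : ∀ {L J} x → J ∣ L → tr L x J ≡ x J
tr-∣ {L} {J} x = if-yes (J ∣? L)

tr-∤ : ∀ {L J} x → ¬ J ∣ L → tr L x J ≡ + 0
tr-∤ {L} {J} x = if-no (J ∣? L)

tr-vanish : ∀ {L J} x → x J ≡ + 0 → tr L x J ≡ + 0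
tr-vanish {L} {J} x x≡0 with J ∣? L
... | yes _ = x≡0
... | no _  = refl

tr-t : ∀ {L m k} q J → L ≡ m * k → 0 < q → 0 < L → tr L (t L k) J ≡ t (q * L) (q * k) J
tr-t {L} {m} {k} q J L≡m*k q>0 L>0 = compare (J ℕ.≟ m)
  where
  k>0 : 0 < k
  k>0 = m*n>0⇒n>0 m (subst (0 <_) L≡m*k L>0)
  L/k≡m : L div k ≡ m
  L/k≡m = exact-div L≡m*k k>0
  qL/qk≡m : (q * L) div (q * k) ≡ m
  qL/qk≡m = exact-div (trans (cong (q *_) L≡m*k) (x∙yz≈y∙xz q m k)) (*-positive q>0 k>0)
  compare : Dec (J ≡ m) → tr L (t L k) J ≡ t (q * L) (q * k) J
  compare (yes refl) = begin
    tr L (t L k) J       ≡⟨ tr-∣ (t L k) (divides k (trans L≡m*k (ℕₚ.*-comm m k))) ⟩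
    t L k J              ≡⟨ t-at {L} {k} L/k≡m ⟩
    + 1                  ≡⟨ t-at {q * L} {q * k} qL/qk≡m ⟨
    t (q * L) (q * k) J  ∎
    where open ≡-Reasoning
  compare (no J≢m) = trans (tr-vanish {L} {J} (t L k) (t-off {L} {k} L/k≡m J≢m))
                           (sym (t-off {q * L} {q * k} qL/qk≡m J≢m))

marks-t : ∀ {M m k} D → M ≡ m * k → 0 < M → marks M (t M k) D ≡ + k ℤ.* χ (D ∣? m)
marks-t {M} {m} {k} D M≡m*k M>0 =
  trans (Σdiv-single M summand M>0 (divides k (trans M≡m*k (ℕₚ.*-comm m k))) vanish) at-m
  where
  summand : ℕ → ℤ
  summand K = if does (D ∣? K) then + (M div K) ℤ.* t M k K else + 0
  M/k≡m : M div k ≡ m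
  M/k≡m = exact-div M≡m*k (m*n>0⇒n>0 m (subst (0 <_) M≡m*k M>0))
  M/m≡k : M div m ≡ k
  M/m≡k = exact-div (trans M≡m*k (ℕₚ.*-comm m k)) (m*n>0⇒m>0 k (subst (0 <_) M≡m*k M>0))
  vanish : ∀ K → K ∣ M → K ≢ m → summand K ≡ + 0
  vanish K _ K≢m with does (D ∣? K)
  ... | true  = trans (cong (+ (M div K) ℤ.*_) (t-off {M} {k} M/k≡m K≢m)) (ℤₚ.*-zeroʳ (+ (M div K)))
  ... | false = refl
  at-m : summand m ≡ + k ℤ.* χ (D ∣? m)
  at-m rewrite M/m≡k | t-at {M} {k} M/k≡m with D ∣? m
  ... | yes _ = refl
  ... | no _  = sym (ℤₚ.*-zeroʳ (+ k))

marks-t-unit : ∀ {M} D → 0 < M → marks M (t M 1) D ≡ χ (D ∣? M)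
marks-t-unit {M} D M>0 = trans (marks-t D (sym (ℕₚ.*-identityʳ M)) M>0) (ℤₚ.*-identityˡ (χ (D ∣? M)))

marks-tr-t : ∀ {q L k} D → 0 < q → 0 < L → k ∣ L →
             marks (q * L) (tr L (t L k)) D ≡ + q ℤ.* marks L (t L k) D
marks-tr-t {q} {L} {k} D q>0 L>0 (divides m L≡m*k) = begin
  marks (q * L) (tr L (t L k)) D
    ≡⟨ cong-pointwise (marks-linear (q * L) D) (λ J → tr-t {L} {m} q J L≡m*k q>0 L>0) ⟩
  marks (q * L) (t (q * L) (q * k)) D
    ≡⟨ marks-t D (trans (cong (q *_) L≡m*k) (x∙yz≈y∙xz q m k)) (*-positive q>0 L>0) ⟩
  + (q * k) ℤ.* χ (D ∣? m)
    ≡⟨ cong (ℤ._* χ (D ∣? m)) (ℤₚ.pos-* q k) ⟩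
  (+ q ℤ.* + k) ℤ.* χ (D ∣? m)
    ≡⟨ ℤₚ.*-assoc (+ q) (+ k) (χ (D ∣? m)) ⟩
  + q ℤ.* (+ k ℤ.* χ (D ∣? m))
    ≡⟨ cong (+ q ℤ.*_) (marks-t D L≡m*k L>0) ⟨
  + q ℤ.* marks L (t L k) D ∎
  where open ≡-Reasoning

marks-scale-t : ∀ {q L k} g → 0 < q → 0 < L → k ∣ L →
                marks (q * L) (t (q * L) k) (q * g) ≡ marks L (t L k) g
marks-scale-t {q} {L} {k} g q>0 L>0 (divides m L≡m*k) = begin
  marks (q * L) (t (q * L) k) (q * g)
    ≡⟨ marks-t (q * g) (trans (cong (q *_) L≡m*k) (sym (ℕₚ.*-assoc q m k))) (*-positive q>0 L>0) ⟩
  + k ℤ.* χ (q * g ∣? q * m)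
    ≡⟨ cong (+ k ℤ.*_) (χ-cong (q * g ∣? q * m) (g ∣? m)
                               (*-cancelˡ-∣ q ⦃ ℕ.>-nonZero q>0 ⦄) (*-monoʳ-∣ q)) ⟩
  + k ℤ.* χ (g ∣? m)
    ≡⟨ marks-t g L≡m*k L>0 ⟨
  marks L (t L k) g ∎
  where open ≡-Reasoning

marks-coprime-t : ∀ {q L k} D → Coprime q k → 0 < q → 0 < L → k ∣ L → D ∣ L →
                  marks (q * L) (t (q * L) k) D ≡ marks L (t L k) D
marks-coprime-t {q} {L} {k} D q⊥k q>0 L>0 (divides m L≡m*k) D∣L = begin
  marks (q * L) (t (q * L) k) D
    ≡⟨ marks-t D (trans (cong (q *_) L≡m*k) (sym (ℕₚ.*-assoc q m k))) (*-positive q>0 L>0) ⟩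
  + k ℤ.* χ (D ∣? q * m)
    ≡⟨ cong (+ k ℤ.*_) (χ-cong (D ∣? q * m) (D ∣? m) D∣m (λ D∣m → ∣-trans D∣m (n∣m*n q))) ⟩
  + k ℤ.* χ (D ∣? m)
    ≡⟨ marks-t D L≡m*k L>0 ⟨
  marks L (t L k) D ∎
  where
  open ≡-Reasoning
  D∣m : D ∣ q * m → D ∣ m
  D∣m D∣qm = coprime-factors q⊥k (D∣qm , subst (D ∣_) (trans L≡m*k (ℕₚ.*-comm m k)) D∣L)

marks-tr-outside : ∀ {M L D} x → ¬ D ∣ L → marks M (tr L x) D ≡ + 0
marks-tr-outside {M} {L} {D} x D∤L = Σdiv-zero M summand vanish
  where
  summand : ℕ → ℤ
  summand K = if does (D ∣? K) then + (M div K) ℤ.* tr L x K else + 0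
  vanish : ∀ K → K ∣ M → summand K ≡ + 0
  vanish K _ with D ∣? K
  ... | yes D∣K = trans (cong (+ (M div K) ℤ.*_) (tr-∤ x (λ K∣L → D∤L (∣-trans D∣K K∣L))))
                        (ℤₚ.*-zeroʳ (+ (M div K)))
  ... | no _    = refl

marks-sub-tr-outside : ∀ {M L D} T z → ¬ D ∣ L → marks M (T -B tr L z) D ≡ marks M T D
marks-sub-tr-outside {M} {L} {D} T z D∤L =
  trans (sub-hom (marks-linear M D) T (tr L z))
        (trans (cong (λ u → marks M T D ℤ.- u) (marks-tr-outside {M} z D∤L)) (ℤₚ.+-identityʳ (marks M T D)))

module _ {q L : ℕ} (q>0 : 0 < q) (L>0 : 0 < L) where

  marks-tr-X : 4 ∣ L → ∀ D → marks (q * L) (tr L (X L)) D ≡ + q ℤ.* marks L (X L) D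
  marks-tr-X 4∣L D = X-agree (marks-tr-linear (q * L) L D) (scaleˡ-linear (+ q) (marks-linear L D))
                             (λ k∣4 → marks-tr-t D q>0 L>0 (∣-trans k∣4 4∣L))

  marks-tr-Y : 2 ∣ L → ∀ D → marks (q * L) (tr L (Y L)) D ≡ + q ℤ.* marks L (Y L) D
  marks-tr-Y 2∣L D = Y-agree (marks-tr-linear (q * L) L D) (scaleˡ-linear (+ q) (marks-linear L D))
                             (λ k∣2 → marks-tr-t D q>0 L>0 (∣-trans k∣2 2∣L))

  marks-scale-X : 4 ∣ L → ∀ g → marks (q * L) (X (q * L)) (q * g) ≡ marks L (X L) g
  marks-scale-X 4∣L g = X-agree (marks-linear (q * L) (q * g)) (marks-linear L g)
                                (λ k∣4 → marks-scale-t g q>0 L>0 (∣-trans k∣4 4∣L))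

  marks-scale-Y : 2 ∣ L → ∀ g → marks (q * L) (Y (q * L)) (q * g) ≡ marks L (Y L) g
  marks-scale-Y 2∣L g = Y-agree (marks-linear (q * L) (q * g)) (marks-linear L g)
                                (λ k∣2 → marks-scale-t g q>0 L>0 (∣-trans k∣2 2∣L))

  marks-coprime-X : (∀ {k} → k ∣ 4 → Coprime q k) → 4 ∣ L → ∀ {D} → D ∣ L →
                    marks (q * L) (X (q * L)) D ≡ marks L (X L) D
  marks-coprime-X q⊥ 4∣L {D} D∣L =
    X-agree (marks-linear (q * L) D) (marks-linear L D)
            (λ k∣4 → marks-coprime-t D (q⊥ k∣4) q>0 L>0 (∣-trans k∣4 4∣L) D∣L)

X-marks : ℤ → ℤ → ℤ → ℤ
X-marks a b c = (+ 4 ℤ.* a ℤ.- + 2 ℤ.* b) ℤ.- + 2 ℤ.* c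

Y-marks : ℤ → ℤ → ℤ
Y-marks b c = + 4 ℤ.* b ℤ.- + 4 ℤ.* c

marks-X : ∀ {L m₄ m₂} D → L ≡ m₄ * 4 → L ≡ m₂ * 2 → 0 < L →
          marks L (X L) D ≡ X-marks (χ (D ∣? m₄)) (χ (D ∣? m₂)) (χ (D ∣? L))
marks-X {L} D L≡m₄*4 L≡m₂*2 L>0 =
  trans (X-expand (marks-linear L D) L)
        (cong₂ ℤ._-_ (cong₂ ℤ._-_ (marks-t D L≡m₄*4 L>0) (marks-t D L≡m₂*2 L>0))
                     (cong (+ 2 ℤ.*_) (marks-t-unit D L>0)))

marks-Y : ∀ {L m₂} D → L ≡ m₂ * 2 → 0 < L → marks L (Y L) D ≡ Y-marks (χ (D ∣? m₂)) (χ (D ∣? L))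
marks-Y {L} {m₂} D L≡m₂*2 L>0 =
  trans (Y-expand (marks-linear L D) L)
        (cong₂ ℤ._-_ (trans (cong (+ 2 ℤ.*_) (marks-t D L≡m₂*2 L>0))
                            (sym (ℤₚ.*-assoc (+ 2) (+ 2) (χ (D ∣? m₂)))))
                     (cong (+ 4 ℤ.*_) (marks-t-unit D L>0)))

res-t : ∀ {M L m k g v} J → M ≡ m * k → 0 < M → gcd m L ≡ g → (M * g) div (m * L) ≡ v →
        res M L (t M k) J ≡ + v ℤ.* χ (J ℕ.≟ g)
res-t {M} {L} {m} {k} {g} {v} J M≡m*k M>0 gcd≡g coefficient≡v =
  trans (Σdiv-single M summand M>0 (divides k (trans M≡m*k (ℕₚ.*-comm m k))) vanish) at-m
  where
  summand : ℕ → ℤ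
  summand K = if does (gcd K L ℕ.≟ J) then t M k K ℤ.* + ((M * gcd K L) div (K * L)) else + 0
  M/k≡m : M div k ≡ m
  M/k≡m = exact-div M≡m*k (m*n>0⇒n>0 m (subst (0 <_) M≡m*k M>0))
  vanish : ∀ K → K ∣ M → K ≢ m → summand K ≡ + 0
  vanish K _ K≢m with does (gcd K L ℕ.≟ J)
  ... | true  = cong (ℤ._* + ((M * gcd K L) div (K * L))) (t-off {M} {k} M/k≡m K≢m)
  ... | false = refl
  at-g : Dec (J ≡ g) → (if does (g ℕ.≟ J) then + 1 ℤ.* + v else + 0) ≡ + v ℤ.* χ (J ℕ.≟ g)
  at-g (yes J≡g) = begin
    (if does (g ℕ.≟ J) then + 1 ℤ.* + v else + 0)  ≡⟨ if-yes (g ℕ.≟ J) (sym J≡g) ⟩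
    + 1 ℤ.* + v                                    ≡⟨ ℤₚ.*-comm (+ 1) (+ v) ⟩
    + v ℤ.* + 1                                    ≡⟨ cong (+ v ℤ.*_) (if-yes (J ℕ.≟ g) J≡g) ⟨
    + v ℤ.* χ (J ℕ.≟ g)                            ∎
    where open ≡-Reasoning
  at-g (no J≢g) = begin
    (if does (g ℕ.≟ J) then + 1 ℤ.* + v else + 0)  ≡⟨ if-no (g ℕ.≟ J) (λ g≡J → J≢g (sym g≡J)) ⟩
    + 0                                            ≡⟨ ℤₚ.*-zeroʳ (+ v) ⟨
    + v ℤ.* + 0                                    ≡⟨ cong (+ v ℤ.*_) (if-no (J ℕ.≟ g) J≢g) ⟨
    + v ℤ.* χ (J ℕ.≟ g)                            ∎
    where open ≡-Reasoning
  at-m : summand m ≡ + v ℤ.* χ (J ℕ.≟ g)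
  at-m rewrite t-at {M} {k} M/k≡m | gcd≡g | coefficient≡v = at-g (J ℕ.≟ g)

res-X≈Y : ∀ {c} → 0 < c → res (c * 4) (c * 2) (X (c * 4)) ≈[ c * 2 ] Y (c * 2)
res-X≈Y {c} c>0 J _ = begin
  res (c * 4) (c * 2) (X (c * 4)) J
    ≡⟨ X-expand (res-linear (c * 4) (c * 2) J) (c * 4) ⟩
  (res (c * 4) (c * 2) (t (c * 4) 4) J ℤ.- res (c * 4) (c * 2) (t (c * 4) 2) J)
    ℤ.- + 2 ℤ.* res (c * 4) (c * 2) (t (c * 4) 1) J
    ≡⟨ cong₂ ℤ._-_ (cong₂ ℤ._-_ res-t₄ res-t₂) (cong (+ 2 ℤ.*_) res-t₁) ⟩
  (+ 2 ℤ.* χ (J ℕ.≟ c) ℤ.- + 2 ℤ.* χ (J ℕ.≟ c * 2)) ℤ.- + 2 ℤ.* (+ 1 ℤ.* χ (J ℕ.≟ c * 2))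
    ≡⟨ collect (χ (J ℕ.≟ c)) (χ (J ℕ.≟ c * 2)) ⟩
  + 2 ℤ.* χ (J ℕ.≟ c) ℤ.- + 4 ℤ.* χ (J ℕ.≟ c * 2)
    ≡⟨ cong₂ (λ a b → + 2 ℤ.* χ (J ℕ.≟ a) ℤ.- + 4 ℤ.* χ (J ℕ.≟ b))
             (exact-div refl (s≤s z≤n)) (exact-div (sym (ℕₚ.*-identityʳ (c * 2))) (s≤s z≤n)) ⟨
  + 2 ℤ.* t (c * 2) 2 J ℤ.- + 4 ℤ.* t (c * 2) 1 J
    ≡⟨ Y-expand (evaluation-linear J) (c * 2) ⟨
  Y (c * 2) J ∎
  where
  open ≡-Reasoning
  c*4>0 : 0 < c * 4
  c*4>0 = *-positive c>0 (s≤s z≤n)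
  c*2>0 : 0 < c * 2
  c*2>0 = *-positive c>0 (s≤s z≤n)
  c*4≡c*2*2 : c * 4 ≡ (c * 2) * 2
  c*4≡c*2*2 = sym (ℕₚ.*-assoc c 2 2)
  c*2∣c*4 : c * 2 ∣ c * 4
  c*2∣c*4 = divides 2 (trans c*4≡c*2*2 (ℕₚ.*-comm (c * 2) 2))
  index₄ : ∀ c → c * 4 * c ≡ 2 * (c * (c * 2))
  index₄ = ℕ-Solver.solve-∀
  index₂ : ∀ c → c * 4 * (c * 2) ≡ 2 * (c * 2 * (c * 2))
  index₂ = ℕ-Solver.solve-∀
  collect : ∀ a b → (+ 2 ℤ.* a ℤ.- + 2 ℤ.* b) ℤ.- + 2 ℤ.* (+ 1 ℤ.* b) ≡ + 2 ℤ.* a ℤ.- + 4 ℤ.* b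
  collect = solve-∀
  res-t₄ : res (c * 4) (c * 2) (t (c * 4) 4) J ≡ + 2 ℤ.* χ (J ℕ.≟ c)
  res-t₄ = res-t {m = c} {g = c} {v = 2} J refl c*4>0
                 (trans (gcd-comm c (c * 2)) (n∣m⇒gcd[m,n]≡n (divides 2 (ℕₚ.*-comm c 2))))
                 (exact-div (index₄ c) (*-positive c>0 c*2>0))
  res-t₂ : res (c * 4) (c * 2) (t (c * 4) 2) J ≡ + 2 ℤ.* χ (J ℕ.≟ c * 2)
  res-t₂ = res-t {m = c * 2} {g = c * 2} {v = 2} J c*4≡c*2*2 c*4>0 (n∣m⇒gcd[m,n]≡n ∣-refl)
                 (exact-div (index₂ c) (*-positive c*2>0 c*2>0))
  res-t₁ : res (c * 4) (c * 2) (t (c * 4) 1) J ≡ + 1 ℤ.* χ (J ℕ.≟ c * 2)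
  res-t₁ = res-t {m = c * 4} {g = c * 2} {v = 1} J (sym (ℕₚ.*-identityʳ (c * 4))) c*4>0
                 (n∣m⇒gcd[m,n]≡n c*2∣c*4) (exact-div (sym (ℕₚ.*-identityˡ _)) (*-positive c*4>0 c*2>0))

-- Norms along a prime index

module _ {q L D : ℕ} (q-prime : Prime q) (L>0 : 0 < L) (D∣qL : D ∣ q * L) (D∤L : ¬ D ∣ L) where

  lcm[L,D]≡q*L : lcm L D ≡ q * L
  lcm[L,D]≡q*L with prime⇒irreducible q-prime a∣q
    where
    a∣q : quotient (m∣lcm[m,n] L D) ∣ q
    a∣q = *-cancelʳ-∣ L ⦃ ℕ.>-nonZero L>0 ⦄
            (subst (_∣ q * L) (_∣_.equality (m∣lcm[m,n] L D)) (lcm-least (n∣m*n q) D∣qL))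
  ... | inj₁ a≡1 = ⊥-elim (D∤L (subst (D ∣_) lcm≡L (n∣lcm[m,n] L D)))
    where
    lcm≡L : lcm L D ≡ L
    lcm≡L = trans (_∣_.equality (m∣lcm[m,n] L D)) (trans (cong (_* L) a≡1) (ℕₚ.*-identityˡ L))
  ... | inj₂ a≡q = trans (_∣_.equality (m∣lcm[m,n] L D)) (cong (_* L) a≡q)

  D≡q*gcd[L,D] : D ≡ q * gcd L D
  D≡q*gcd[L,D] = ℕₚ.*-cancelˡ-≡ D (q * gcd L D) L ⦃ ℕ.>-nonZero L>0 ⦄ (begin
    L * D               ≡⟨ gcd*lcm L D ⟨
    gcd L D * lcm L D   ≡⟨ cong (gcd L D *_) lcm[L,D]≡q*L ⟩
    gcd L D * (q * L)   ≡⟨ x∙yz≈y∙xz (gcd L D) q L ⟩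
    q * (gcd L D * L)   ≡⟨ cong (q *_) (ℕₚ.*-comm (gcd L D) L) ⟩
    q * (L * gcd L D)   ≡⟨ x∙yz≈y∙xz q L (gcd L D) ⟩
    L * (q * gcd L D)   ∎)
    where open ≡-Reasoning

isNorm-by-cases : ∀ {q L x y} → Prime q → 0 < L →
                  (∀ D → D ∣ L → marks (q * L) y D ≡ marks L x D ℤ.^ q) →
                  (∀ g → g ∣ L → ¬ q * g ∣ L → marks (q * L) y (q * g) ≡ marks L x g) →
                  IsNorm L (q * L) x y
isNorm-by-cases {q} {L} {x} {y} q-prime L>0 inside outside D D∣qL with D ∣? L
... | yes D∣L = begin
  marks (q * L) y D
    ≡⟨ inside D D∣L ⟩
  marks L x D ℤ.^ q
    ≡⟨ cong₂ ℤ._^_ (cong (marks L x) (n∣m⇒gcd[m,n]≡n D∣L)) qL/lcm≡q ⟨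
  marks L x (gcd L D) ℤ.^ ((q * L) div lcm L D) ∎
  where
  open ≡-Reasoning
  qL/lcm≡q : (q * L) div lcm L D ≡ q
  qL/lcm≡q = trans (cong ((q * L) div_) (n∣m⇒lcm[m,n]≡m D∣L)) (exact-div refl L>0)
... | no D∤L = begin
  marks (q * L) y D                      ≡⟨ cong (marks (q * L) y) (D≡q*gcd[L,D] q-prime L>0 D∣qL D∤L) ⟩
  marks (q * L) y (q * g)                ≡⟨ outside g (gcd[m,n]∣m L D) qg∤L ⟩
  marks L x g                            ≡⟨ ℤₚ.^-identityʳ (marks L x g) ⟨
  marks L x g ℤ.^ 1                      ≡⟨ cong (marks L x g ℤ.^_) qL/lcm≡1 ⟨
  marks L x g ℤ.^ ((q * L) div lcm L D)  ∎
  where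
  open ≡-Reasoning
  g : ℕ
  g = gcd L D
  qg∤L : ¬ q * g ∣ L
  qg∤L qg∣L = D∤L (subst (_∣ L) (sym (D≡q*gcd[L,D] q-prime L>0 D∣qL D∤L)) qg∣L)
  qL/lcm≡1 : (q * L) div lcm L D ≡ 1
  qL/lcm≡1 = trans (cong ((q * L) div_) (lcm[L,D]≡q*L q-prime L>0 D∣qL D∤L))
                   (exact-div (sym (ℕₚ.*-identityˡ (q * L))) (*-positive (prime>0 q-prime) L>0))

isNorm-zero : ∀ {q L} → Prime q → 0 < L → IsNorm L (q * L) 0B 0B
isNorm-zero {q} {L} q-prime L>0 = isNorm-by-cases q-prime L>0 inside outside
  where
  0^n≡0 : ∀ {n} → 0 < n → (+ 0) ℤ.^ n ≡ + 0
  0^n≡0 (s≤s z≤n) = refl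
  inside : ∀ D → D ∣ L → marks (q * L) 0B D ≡ marks L 0B D ℤ.^ q
  inside D _ = begin
    marks (q * L) 0B D  ≡⟨ zero-hom (marks-linear (q * L) D) ⟩
    + 0                 ≡⟨ 0^n≡0 (prime>0 q-prime) ⟨
    (+ 0) ℤ.^ q         ≡⟨ cong (ℤ._^ q) (zero-hom (marks-linear L D)) ⟨
    marks L 0B D ℤ.^ q  ∎
    where open ≡-Reasoning
  outside : ∀ g → g ∣ L → ¬ q * g ∣ L → marks (q * L) 0B (q * g) ≡ marks L 0B g
  outside g _ _ = trans (zero-hom (marks-linear (q * L) (q * g))) (sym (zero-hom (marks-linear L g)))

X-doubling-arith : ∀ {A B C E : Set} (a : Dec A) (b : Dec B) (c : Dec C) (e : Dec E) →
                   (A → B) → C → E →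
                   X-marks (χ b) (χ c) (χ e) ℤ.- + 2 ℤ.* (+ 2 ℤ.* X-marks (χ a) (χ b) (χ c))
                   ≡ X-marks (χ a) (χ b) (χ c) ℤ.^ 2
X-doubling-arith (yes _) (yes _) (yes _) (yes _) _   _ _ = refl
X-doubling-arith (no _)  (yes _) (yes _) (yes _) _   _ _ = refl
X-doubling-arith (no _)  (no _)  (yes _) (yes _) _   _ _ = refl
X-doubling-arith (yes a) (no ¬b) _       _       a⇒b _ _ = ⊥-elim (¬b (a⇒b a))
X-doubling-arith _       _       (no ¬c) _       _   c _ = ⊥-elim (¬c c)
X-doubling-arith _       _       _       (no ¬e) _   _ e = ⊥-elim (¬e e)

X-doubling-norm : ∀ {L} → 4 ∣ L → 0 < L → IsNorm L (2 * L) (X L) (X (2 * L) -B tr L ((+ 2) ·B X L))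
X-doubling-norm {L} 4∣L@(divides c L≡c*4) L>0 = isNorm-by-cases prime[2] L>0 inside outside
  where
  y : Bur
  y = X (2 * L) -B tr L ((+ 2) ·B X L)
  inside : ∀ D → D ∣ L → marks (2 * L) y D ≡ marks L (X L) D ℤ.^ 2
  inside D D∣L = begin
    marks (2 * L) y D
      ≡⟨ sub-hom (marks-linear (2 * L) D) _ _ ⟩
    marks (2 * L) (X (2 * L)) D ℤ.- marks (2 * L) (tr L ((+ 2) ·B X L)) D
      ≡⟨ cong₂ ℤ._-_ (marks-X D (trans (cong (2 *_) L≡c*4) (x∙yz≈yx∙z 2 c 4)) (ℕₚ.*-comm 2 L)
                               (*-positive {2} (s≤s z≤n) L>0))
                     (trans (·-hom (marks-tr-linear (2 * L) L D) (+ 2) (X L))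
                            (cong (+ 2 ℤ.*_) (marks-tr-X {2} (s≤s z≤n) L>0 4∣L D))) ⟩
    x₂ ℤ.- + 2 ℤ.* (+ 2 ℤ.* marks L (X L) D)
      ≡⟨ cong (λ u → x₂ ℤ.- + 2 ℤ.* (+ 2 ℤ.* u)) x₁≡ ⟩
    x₂ ℤ.- + 2 ℤ.* (+ 2 ℤ.* x₁)
      ≡⟨ X-doubling-arith (D ∣? c) (D ∣? c * 2) (D ∣? L) (D ∣? 2 * L)
                          (λ D∣c → ∣-trans D∣c (m∣m*n 2)) D∣L (∣-trans D∣L (n∣m*n 2)) ⟩
    x₁ ℤ.^ 2
      ≡⟨ cong (ℤ._^ 2) x₁≡ ⟨
    marks L (X L) D ℤ.^ 2 ∎
    where
    open ≡-Reasoning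
    x₁ x₂ : ℤ
    x₁ = X-marks (χ (D ∣? c)) (χ (D ∣? c * 2)) (χ (D ∣? L))
    x₂ = X-marks (χ (D ∣? c * 2)) (χ (D ∣? L)) (χ (D ∣? 2 * L))
    x₁≡ : marks L (X L) D ≡ x₁
    x₁≡ = marks-X D L≡c*4 (trans L≡c*4 (sym (ℕₚ.*-assoc c 2 2))) L>0
  outside : ∀ g → g ∣ L → ¬ 2 * g ∣ L → marks (2 * L) y (2 * g) ≡ marks L (X L) g
  outside g _ 2g∤L = trans (marks-sub-tr-outside {2 * L} (X (2 * L)) ((+ 2) ·B X L) 2g∤L)
                           (marks-scale-X {2} (s≤s z≤n) L>0 4∣L g)

Y-doubling-arith : ∀ {A C E : Set} (a : Dec A) (c : Dec C) (e : Dec E) → C → E →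
                   Y-marks (χ c) (χ e) ℤ.- + 2 ℤ.* (+ 2 ℤ.* Y-marks (χ a) (χ c))
                   ≡ Y-marks (χ a) (χ c) ℤ.^ 2
Y-doubling-arith (yes _) (yes _) (yes _) _ _ = refl
Y-doubling-arith (no _)  (yes _) (yes _) _ _ = refl
Y-doubling-arith _       (no ¬c) _       c _ = ⊥-elim (¬c c)
Y-doubling-arith _       _       (no ¬e) _ e = ⊥-elim (¬e e)

Y-doubling-norm : ∀ {L} → 2 ∣ L → 0 < L → IsNorm L (2 * L) (Y L) (Y (2 * L) -B tr L ((+ 2) ·B Y L))
Y-doubling-norm {L} 2∣L@(divides c L≡c*2) L>0 = isNorm-by-cases prime[2] L>0 inside outside
  where
  y : Bur
  y = Y (2 * L) -B tr L ((+ 2) ·B Y L)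
  inside : ∀ D → D ∣ L → marks (2 * L) y D ≡ marks L (Y L) D ℤ.^ 2
  inside D D∣L = begin
    marks (2 * L) y D
      ≡⟨ sub-hom (marks-linear (2 * L) D) _ _ ⟩
    marks (2 * L) (Y (2 * L)) D ℤ.- marks (2 * L) (tr L ((+ 2) ·B Y L)) D
      ≡⟨ cong₂ ℤ._-_ (marks-Y D (ℕₚ.*-comm 2 L) (*-positive {2} (s≤s z≤n) L>0))
                     (trans (·-hom (marks-tr-linear (2 * L) L D) (+ 2) (Y L))
                            (cong (+ 2 ℤ.*_) (marks-tr-Y {2} (s≤s z≤n) L>0 2∣L D))) ⟩
    y₂ ℤ.- + 2 ℤ.* (+ 2 ℤ.* marks L (Y L) D)
      ≡⟨ cong (λ u → y₂ ℤ.- + 2 ℤ.* (+ 2 ℤ.* u)) y₁≡ ⟩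
    y₂ ℤ.- + 2 ℤ.* (+ 2 ℤ.* y₁)
      ≡⟨ Y-doubling-arith (D ∣? c) (D ∣? L) (D ∣? 2 * L) D∣L (∣-trans D∣L (n∣m*n 2)) ⟩
    y₁ ℤ.^ 2
      ≡⟨ cong (ℤ._^ 2) y₁≡ ⟨
    marks L (Y L) D ℤ.^ 2 ∎
    where
    open ≡-Reasoning
    y₁ y₂ : ℤ
    y₁ = Y-marks (χ (D ∣? c)) (χ (D ∣? L))
    y₂ = Y-marks (χ (D ∣? L)) (χ (D ∣? 2 * L))
    y₁≡ : marks L (Y L) D ≡ y₁
    y₁≡ = marks-Y D L≡c*2 L>0
  outside : ∀ g → g ∣ L → ¬ 2 * g ∣ L → marks (2 * L) y (2 * g) ≡ marks L (Y L) g
  outside g _ 2g∤L = trans (marks-sub-tr-outside {2 * L} (Y (2 * L)) ((+ 2) ·B Y L) 2g∤L)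
                           (marks-scale-Y {2} (s≤s z≤n) L>0 2∣L g)

-- Fermat's little theorem for the base 2

binomial-prefix : ℕ → ℕ → ℕ
binomial-prefix n zero    = 0
binomial-prefix n (suc m) = binomial-prefix n m + n C m

binomial-prefix-pascal : ∀ n m →
  binomial-prefix (suc n) (suc m) ≡ binomial-prefix n (suc m) + binomial-prefix n m
binomial-prefix-pascal n zero    = refl
binomial-prefix-pascal n (suc m) = begin
  binomial-prefix (suc n) (suc m) + suc n C suc m
    ≡⟨ cong₂ _+_ (binomial-prefix-pascal n m) (sym (nCk+nC[k+1]≡[n+1]C[k+1] n m)) ⟩
  (binomial-prefix n (suc m) + binomial-prefix n m) + (n C m + n C suc m)
    ≡⟨ cong (_+_ (binomial-prefix n (suc m) + binomial-prefix n m)) (ℕₚ.+-comm (n C m) (n C suc m)) ⟩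
  (binomial-prefix n (suc m) + binomial-prefix n m) + (n C suc m + n C m)
    ≡⟨ ℕ+.interchange (binomial-prefix n (suc m)) _ _ _ ⟩
  binomial-prefix n (suc (suc m)) + binomial-prefix n (suc m) ∎
  where open ≡-Reasoning

binomial-row-sum : ∀ n → binomial-prefix n (suc n) ≡ 2 ^ n
binomial-row-sum zero    = refl
binomial-row-sum (suc n) = begin
  binomial-prefix (suc n) (suc (suc n))
    ≡⟨ binomial-prefix-pascal n (suc n) ⟩
  (row + n C suc n) + row
    ≡⟨ cong (λ c → (row + c) + row) (k>n⇒nCk≡0 (ℕₚ.n<1+n n)) ⟩
  (row + 0) + row
    ≡⟨ cong₂ _+_ (trans (ℕₚ.+-identityʳ row) (binomial-row-sum n)) (binomial-row-sum n) ⟩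
  2 ^ n + 2 ^ n
    ≡⟨ cong (_+_ (2 ^ n)) (ℕₚ.+-identityʳ (2 ^ n)) ⟨
  2 ^ suc n ∎
  where
  open ≡-Reasoning
  row : ℕ
  row = binomial-prefix n (suc n)

[1+k]*[1+n]C[1+k]≡[1+n]*nCk : ∀ n k → suc k * (suc n C suc k) ≡ suc n * (n C k)
[1+k]*[1+n]C[1+k]≡[1+n]*nCk zero    zero    = refl
[1+k]*[1+n]C[1+k]≡[1+n]*nCk zero    (suc k) = ℕₚ.*-zeroʳ (suc (suc k))
[1+k]*[1+n]C[1+k]≡[1+n]*nCk (suc n) zero    =
  trans (ℕₚ.*-identityˡ _) (trans (nC1≡n (suc (suc n))) (sym (ℕₚ.*-identityʳ (suc (suc n)))))
[1+k]*[1+n]C[1+k]≡[1+n]*nCk (suc n) (suc k) = begin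
  suc (suc k) * (suc (suc n) C suc (suc k))
    ≡⟨ cong (suc (suc k) *_) (nCk+nC[k+1]≡[n+1]C[k+1] (suc n) (suc k)) ⟨
  suc (suc k) * (a + suc n C suc (suc k))
    ≡⟨ ℕₚ.*-distribˡ-+ (suc (suc k)) a _ ⟩
  (a + suc k * a) + suc (suc k) * (suc n C suc (suc k))
    ≡⟨ cong₂ _+_ (cong (_+_ a) ([1+k]*[1+n]C[1+k]≡[1+n]*nCk n k)) ([1+k]*[1+n]C[1+k]≡[1+n]*nCk n (suc k)) ⟩
  (a + suc n * (n C k)) + suc n * (n C suc k)
    ≡⟨ ℕₚ.+-assoc a _ _ ⟩
  a + (suc n * (n C k) + suc n * (n C suc k))
    ≡⟨ cong (_+_ a) (ℕₚ.*-distribˡ-+ (suc n) (n C k) (n C suc k)) ⟨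
  a + suc n * (n C k + n C suc k)
    ≡⟨ cong (λ c → a + suc n * c) (nCk+nC[k+1]≡[n+1]C[k+1] n k) ⟩
  suc (suc n) * a ∎
  where
  open ≡-Reasoning
  a : ℕ
  a = suc n C suc k

p∣pCk : ∀ {p k} → Prime p → 0 < k → k < p → p ∣ p C k
p∣pCk {suc n} {suc k} p-prime _ k<p
  with euclidsLemma (suc k) (suc n C suc k) p-prime
                    (divides (n C k) (trans ([1+k]*[1+n]C[1+k]≡[1+n]*nCk n k) (ℕₚ.*-comm (suc n) (n C k))))
... | inj₁ p∣k = ⊥-elim (ℕₚ.<⇒≱ k<p (∣⇒≤ p∣k))
... | inj₂ p∣C = p∣C

binomial-prefix-mod-prime : ∀ {p m} → Prime p → 0 < m → m ≤ p → ∃[ s ] binomial-prefix p m ≡ 1 + s * p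
binomial-prefix-mod-prime {p} {suc zero}    _       _ _   = 0 , refl
binomial-prefix-mod-prime {p} {suc (suc m)} p-prime _ m<p
  with binomial-prefix-mod-prime p-prime (s≤s z≤n) (ℕₚ.<⇒≤ m<p) | p∣pCk p-prime (s≤s z≤n) m<p
... | s , prefix≡ | divides b C≡b*p = s + b , (begin
  binomial-prefix p (suc m) + p C suc m  ≡⟨ cong₂ _+_ prefix≡ C≡b*p ⟩
  (1 + s * p) + b * p                    ≡⟨ ℕₚ.+-assoc 1 (s * p) (b * p) ⟩
  1 + (s * p + b * p)                    ≡⟨ cong (_+_ 1) (ℕₚ.*-distribʳ-+ p s b) ⟨
  1 + (s + b) * p                        ∎)
  where open ≡-Reasoning

fermat₂ : ∀ {p} → Prime p → ∃[ s ] 2 ^ p ≡ s * p + 2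
fermat₂ {p} p-prime with binomial-prefix-mod-prime p-prime (prime>0 p-prime) ℕₚ.≤-refl
... | s , prefix≡ = s , (begin
  2 ^ p                        ≡⟨ binomial-row-sum p ⟨
  binomial-prefix p p + p C p  ≡⟨ cong₂ _+_ prefix≡ (nCn≡1 p) ⟩
  suc (s * p) + 1              ≡⟨ ℕₚ.+-suc (s * p) 1 ⟨
  s * p + 2                    ∎)
  where open ≡-Reasoning

fermat₂-odd : ∀ {n} → Prime (suc n) → ¬ 2 ∣ suc n → ∃[ h ] 2 ^ n ≡ h * suc n + 1
fermat₂-odd {n} p-prime p-odd with fermat₂ p-prime
... | s , 2^p≡ with euclidsLemma s (suc n) prime[2] (∣m+n∣m⇒∣n 2∣2+sp ∣-refl)
  where
  2∣2+sp : 2 ∣ 2 + s * suc n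
  2∣2+sp = divides (2 ^ n) (trans (ℕₚ.+-comm 2 (s * suc n)) (trans (sym 2^p≡) (ℕₚ.*-comm 2 (2 ^ n))))
...   | inj₂ 2∣p = ⊥-elim (p-odd 2∣p)
...   | inj₁ (divides h s≡h*2) = h , ℕₚ.*-cancelˡ-≡ (2 ^ n) (h * suc n + 1) 2 (begin
  2 * 2 ^ n            ≡⟨ 2^p≡ ⟩
  s * suc n + 2        ≡⟨ cong (λ s → s * suc n + 2) s≡h*2 ⟩
  h * 2 * suc n + 2    ≡⟨ rearrange h (suc n) ⟩
  2 * (h * suc n + 1)  ∎)
  where
  open ≡-Reasoning
  rearrange : ∀ h p → h * 2 * p + 2 ≡ 2 * (h * p + 1)
  rearrange = ℕ-Solver.solve-∀

neg-^-odd : ∀ a {n} → ¬ 2 ∣ n → (ℤ.- a) ℤ.^ n ≡ ℤ.- (a ℤ.^ n)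
neg-^-odd a {zero}        n-odd = ⊥-elim (n-odd (2 ∣0))
neg-^-odd a {suc zero}    _     = sym (ℤₚ.neg-distribˡ-* a (+ 1))
neg-^-odd a {suc (suc n)} n-odd = begin
  (ℤ.- a) ℤ.* ((ℤ.- a) ℤ.* (ℤ.- a) ℤ.^ n)
    ≡⟨ cong (λ u → (ℤ.- a) ℤ.* ((ℤ.- a) ℤ.* u)) (neg-^-odd a n-2-odd) ⟩
  (ℤ.- a) ℤ.* ((ℤ.- a) ℤ.* ℤ.- (a ℤ.^ n))
    ≡⟨ two-negations a (a ℤ.^ n) ⟩
  ℤ.- (a ℤ.* (a ℤ.* a ℤ.^ n)) ∎
  where
  open ≡-Reasoning
  n-2-odd : ¬ 2 ∣ n
  n-2-odd 2∣n = n-odd (∣m∣n⇒∣m+n ∣-refl 2∣n)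
  two-negations : ∀ a b → (ℤ.- a) ℤ.* ((ℤ.- a) ℤ.* ℤ.- b) ≡ ℤ.- (a ℤ.* (a ℤ.* b))
  two-negations = solve-∀

pos-^ : ∀ m n → + (m ^ n) ≡ (+ m) ℤ.^ n
pos-^ m zero    = refl
pos-^ m (suc n) = trans (ℤₚ.pos-* m (m ^ n)) (cong (+ m ℤ.*_) (pos-^ m n))

^-distribʳ-* : ∀ a b n → (a ℤ.* b) ℤ.^ n ≡ a ℤ.^ n ℤ.* b ℤ.^ n
^-distribʳ-* a b zero    = refl
^-distribʳ-* a b (suc n) =
  trans (cong ((a ℤ.* b) ℤ.*_) (^-distribʳ-* a b n)) (regroup a b (a ℤ.^ n) (b ℤ.^ n))
  where
  regroup : ∀ a b x y → (a ℤ.* b) ℤ.* (x ℤ.* y) ≡ (a ℤ.* x) ℤ.* (b ℤ.* y)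
  regroup = solve-∀

odd-prime∤2 : ∀ {p} → Prime p → ¬ 2 ∣ p → ¬ p ∣ 2
odd-prime∤2 p-prime p-odd p∣2 with prime⇒irreducible prime[2] p∣2
... | inj₁ refl = ¬prime[1] p-prime
... | inj₂ refl = p-odd ∣-refl

odd-prime-coprime : ∀ {p k} → Prime p → ¬ 2 ∣ p → k ∣ 4 → Coprime p k
odd-prime-coprime p-prime p-odd k∣4 (i∣p , i∣k) with prime⇒irreducible p-prime i∣p
... | inj₁ i≡1 = i≡1
... | inj₂ refl with euclidsLemma 2 2 p-prime (∣-trans i∣k k∣4)
...   | inj₁ p∣2 = ⊥-elim (odd-prime∤2 p-prime p-odd p∣2)
...   | inj₂ p∣2 = ⊥-elim (odd-prime∤2 p-prime p-odd p∣2)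

-- On the subgroups of C_L the marks of X are 0, -4 or -2 and those of Y are 0, 0 or -4 respectively;
-- matching x - p (α x + β y) with x ^ p there forces p α = 1 - 4^(p-1) and p β = 2^(p-2) (2^(p-1) - 1),
-- which are divisible by p because h p = 2^(p-1) - 1.
module OddPrimeNorm {k h : ℕ} (p-prime : Prime (2 + k)) (p-odd : ¬ 2 ∣ 2 + k)
                    (fermat : 2 ^ suc k ≡ h * (2 + k) + 1) where

  H P W : ℤ
  H = + h
  P = + (2 + k)
  W = + (2 ^ k)

  α β : ℤ
  α = ℤ.- (H ℤ.* (+ 2 ℤ.* W ℤ.+ + 1))
  β = H ℤ.* W

  HP+1≡2W : H ℤ.* P ℤ.+ + 1 ≡ + 2 ℤ.* W
  HP+1≡2W = begin
    H ℤ.* P ℤ.+ + 1          ≡⟨ cong (ℤ._+ + 1) (ℤₚ.pos-* h (2 + k)) ⟨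
    + (h * (2 + k)) ℤ.+ + 1  ≡⟨ ℤₚ.pos-+ (h * (2 + k)) 1 ⟨
    + (h * (2 + k) + 1)      ≡⟨ cong +_ fermat ⟨
    + (2 * 2 ^ k)            ≡⟨ ℤₚ.pos-* 2 (2 ^ k) ⟩
    + 2 ℤ.* W                ∎
    where open ≡-Reasoning

  2^p≡4W : (+ 2) ℤ.^ (2 + k) ≡ + 4 ℤ.* W
  2^p≡4W = begin
    (+ 2) ℤ.^ (2 + k)    ≡⟨ pos-^ 2 (2 + k) ⟨
    + (2 * (2 * 2 ^ k))  ≡⟨ cong +_ (ℕₚ.*-assoc 2 2 (2 ^ k)) ⟨
    + (4 * 2 ^ k)        ≡⟨ ℤₚ.pos-* 4 (2 ^ k) ⟩
    + 4 ℤ.* W            ∎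
    where open ≡-Reasoning

  [-2]^p : -[1+ 1 ] ℤ.^ (2 + k) ≡ ℤ.- (+ 4 ℤ.* W)
  [-2]^p = trans (neg-^-odd (+ 2) p-odd) (cong ℤ.-_ 2^p≡4W)

  [-4]^p : -[1+ 3 ] ℤ.^ (2 + k) ≡ ℤ.- (+ 4 ℤ.* W) ℤ.* (+ 4 ℤ.* W)
  [-4]^p = trans (^-distribʳ-* -[1+ 1 ] (+ 2) (2 + k)) (cong₂ ℤ._*_ [-2]^p 2^p≡4W)

  private
    at-0 : + 0 ℤ.- (α ℤ.* (P ℤ.* + 0) ℤ.+ β ℤ.* (P ℤ.* + 0)) ≡ (+ 0) ℤ.^ (2 + k)
    at-0 = vanish α β P
      where
      vanish : ∀ a b p → + 0 ℤ.- (a ℤ.* (p ℤ.* + 0) ℤ.+ b ℤ.* (p ℤ.* + 0)) ≡ + 0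
      vanish = solve-∀

    at-[-4] : -[1+ 3 ] ℤ.- (α ℤ.* (P ℤ.* -[1+ 3 ]) ℤ.+ β ℤ.* (P ℤ.* + 0)) ≡ -[1+ 3 ] ℤ.^ (2 + k)
    at-[-4] = begin
      -[1+ 3 ] ℤ.- (α ℤ.* (P ℤ.* -[1+ 3 ]) ℤ.+ β ℤ.* (P ℤ.* + 0))
        ≡⟨ expand H P W ⟩
      -[1+ 3 ] ℤ.- + 4 ℤ.* ((H ℤ.* P ℤ.+ + 1) ℤ.- + 1) ℤ.* (+ 2 ℤ.* W ℤ.+ + 1)
        ≡⟨ cong (λ u → -[1+ 3 ] ℤ.- + 4 ℤ.* (u ℤ.- + 1) ℤ.* (+ 2 ℤ.* W ℤ.+ + 1)) HP+1≡2W ⟩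
      -[1+ 3 ] ℤ.- + 4 ℤ.* (+ 2 ℤ.* W ℤ.- + 1) ℤ.* (+ 2 ℤ.* W ℤ.+ + 1)
        ≡⟨ simplify W ⟩
      ℤ.- (+ 4 ℤ.* W) ℤ.* (+ 4 ℤ.* W)
        ≡⟨ [-4]^p ⟨
      -[1+ 3 ] ℤ.^ (2 + k) ∎
      where
      open ≡-Reasoning
      expand : ∀ H P W →
               -[1+ 3 ] ℤ.- (ℤ.- (H ℤ.* (+ 2 ℤ.* W ℤ.+ + 1)) ℤ.* (P ℤ.* -[1+ 3 ])
                             ℤ.+ (H ℤ.* W) ℤ.* (P ℤ.* + 0))
               ≡ -[1+ 3 ] ℤ.- + 4 ℤ.* ((H ℤ.* P ℤ.+ + 1) ℤ.- + 1) ℤ.* (+ 2 ℤ.* W ℤ.+ + 1)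
      expand = solve-∀
      simplify : ∀ W → -[1+ 3 ] ℤ.- + 4 ℤ.* (+ 2 ℤ.* W ℤ.- + 1) ℤ.* (+ 2 ℤ.* W ℤ.+ + 1)
                       ≡ ℤ.- (+ 4 ℤ.* W) ℤ.* (+ 4 ℤ.* W)
      simplify = solve-∀

    at-[-2] : -[1+ 1 ] ℤ.- (α ℤ.* (P ℤ.* -[1+ 1 ]) ℤ.+ β ℤ.* (P ℤ.* -[1+ 3 ])) ≡ -[1+ 1 ] ℤ.^ (2 + k)
    at-[-2] = begin
      -[1+ 1 ] ℤ.- (α ℤ.* (P ℤ.* -[1+ 1 ]) ℤ.+ β ℤ.* (P ℤ.* -[1+ 3 ]))
        ≡⟨ expand H P W ⟩
      -[1+ 1 ] ℤ.- + 2 ℤ.* ((H ℤ.* P ℤ.+ + 1) ℤ.- + 1)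
        ≡⟨ cong (λ u → -[1+ 1 ] ℤ.- + 2 ℤ.* (u ℤ.- + 1)) HP+1≡2W ⟩
      -[1+ 1 ] ℤ.- + 2 ℤ.* (+ 2 ℤ.* W ℤ.- + 1)
        ≡⟨ simplify W ⟩
      ℤ.- (+ 4 ℤ.* W)
        ≡⟨ [-2]^p ⟨
      -[1+ 1 ] ℤ.^ (2 + k) ∎
      where
      open ≡-Reasoning
      expand : ∀ H P W →
               -[1+ 1 ] ℤ.- (ℤ.- (H ℤ.* (+ 2 ℤ.* W ℤ.+ + 1)) ℤ.* (P ℤ.* -[1+ 1 ])
                             ℤ.+ (H ℤ.* W) ℤ.* (P ℤ.* -[1+ 3 ]))
               ≡ -[1+ 1 ] ℤ.- + 2 ℤ.* ((H ℤ.* P ℤ.+ + 1) ℤ.- + 1)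
      expand = solve-∀
      simplify : ∀ W → -[1+ 1 ] ℤ.- + 2 ℤ.* (+ 2 ℤ.* W ℤ.- + 1) ≡ ℤ.- (+ 4 ℤ.* W)
      simplify = solve-∀

  X-odd-arith : ∀ {A B C : Set} (a : Dec A) (b : Dec B) (c : Dec C) → (A → B) → C →
                X-marks (χ a) (χ b) (χ c)
                  ℤ.- (α ℤ.* (P ℤ.* X-marks (χ a) (χ b) (χ c)) ℤ.+ β ℤ.* (P ℤ.* Y-marks (χ b) (χ c)))
                ≡ X-marks (χ a) (χ b) (χ c) ℤ.^ (2 + k)
  X-odd-arith (yes _) (yes _) (yes _) _   _ = at-0
  X-odd-arith (no _)  (yes _) (yes _) _   _ = at-[-4]
  X-odd-arith (no _)  (no _)  (yes _) _   _ = at-[-2]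
  X-odd-arith (yes a) (no ¬b) _       a⇒b _ = ⊥-elim (¬b (a⇒b a))
  X-odd-arith _       _       (no ¬c) _   c = ⊥-elim (¬c c)

  X-odd-norm : ∀ {L} → 4 ∣ L → 0 < L →
               IsNorm L ((2 + k) * L) (X L) (X ((2 + k) * L) -B tr L ((α ·B X L) +B (β ·B Y L)))
  X-odd-norm {L} 4∣L@(divides c L≡c*4) L>0 = isNorm-by-cases p-prime L>0 inside outside
    where
    p>0 : 0 < 2 + k
    p>0 = s≤s z≤n
    L≡c*2*2 : L ≡ (c * 2) * 2
    L≡c*2*2 = trans L≡c*4 (sym (ℕₚ.*-assoc c 2 2))
    z : Bur
    z = (α ·B X L) +B (β ·B Y L)
    inside : ∀ D → D ∣ L → marks ((2 + k) * L) (X ((2 + k) * L) -B tr L z) D ≡ marks L (X L) D ℤ.^ (2 + k)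
    inside D D∣L = begin
      marks ((2 + k) * L) (X ((2 + k) * L) -B tr L z) D
        ≡⟨ sub-hom (marks-linear ((2 + k) * L) D) _ _ ⟩
      marks ((2 + k) * L) (X ((2 + k) * L)) D ℤ.- marks ((2 + k) * L) (tr L z) D
        ≡⟨ cong₂ ℤ._-_ (marks-coprime-X p>0 L>0 (odd-prime-coprime p-prime p-odd) 4∣L D∣L) tr-z ⟩
      marks L (X L) D ℤ.- (α ℤ.* (P ℤ.* marks L (X L) D) ℤ.+ β ℤ.* (P ℤ.* marks L (Y L) D))
        ≡⟨ cong₂ (λ x y → x ℤ.- (α ℤ.* (P ℤ.* x) ℤ.+ β ℤ.* (P ℤ.* y))) x≡ y≡ ⟩
      x ℤ.- (α ℤ.* (P ℤ.* x) ℤ.+ β ℤ.* (P ℤ.* y))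
        ≡⟨ X-odd-arith (D ∣? c) (D ∣? c * 2) (D ∣? L) (λ D∣c → ∣-trans D∣c (m∣m*n 2)) D∣L ⟩
      x ℤ.^ (2 + k)
        ≡⟨ cong (ℤ._^ (2 + k)) x≡ ⟨
      marks L (X L) D ℤ.^ (2 + k) ∎
      where
      open ≡-Reasoning
      x y : ℤ
      x = X-marks (χ (D ∣? c)) (χ (D ∣? c * 2)) (χ (D ∣? L))
      y = Y-marks (χ (D ∣? c * 2)) (χ (D ∣? L))
      x≡ : marks L (X L) D ≡ x
      x≡ = marks-X D L≡c*4 L≡c*2*2 L>0
      y≡ : marks L (Y L) D ≡ y
      y≡ = marks-Y D L≡c*2*2 L>0
      tr-z : marks ((2 + k) * L) (tr L z) D
             ≡ α ℤ.* (P ℤ.* marks L (X L) D) ℤ.+ β ℤ.* (P ℤ.* marks L (Y L) D)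
      tr-z = trans (+-hom (marks-tr-linear ((2 + k) * L) L D) (α ·B X L) (β ·B Y L))
                   (cong₂ ℤ._+_ (trans (·-hom (marks-tr-linear ((2 + k) * L) L D) α (X L))
                                       (cong (α ℤ.*_) (marks-tr-X p>0 L>0 4∣L D)))
                                (trans (·-hom (marks-tr-linear ((2 + k) * L) L D) β (Y L))
                                       (cong (β ℤ.*_) (marks-tr-Y p>0 L>0 (divides (c * 2) L≡c*2*2) D))))
    outside : ∀ g → g ∣ L → ¬ (2 + k) * g ∣ L →
              marks ((2 + k) * L) (X ((2 + k) * L) -B tr L z) ((2 + k) * g) ≡ marks L (X L) g
    outside g _ pg∤L = trans (marks-sub-tr-outside {(2 + k) * L} (X ((2 + k) * L)) z pg∤L)
                             (marks-scale-X p>0 L>0 4∣L g)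

Z₁≈Y : ∀ L → Z L 1 ≈[ L ] Y L
Z₁≈Y L J _ = double (t L 2 J) (t L 1 J)
  where
  double : ∀ a b → (a ℤ.+ a) ℤ.- + 4 ℤ.* b ≡ + 2 ℤ.* a ℤ.- + 4 ℤ.* b
  double = solve-∀

X+Y≈Z₂ : ∀ L → (X L +B Y L) ≈[ L ] Z L 2
X+Y≈Z₂ L J _ = collect (t L 4 J) (t L 2 J) (t L 1 J)
  where
  collect : ∀ a b c → ((a ℤ.- b) ℤ.- + 2 ℤ.* c) ℤ.+ (+ 2 ℤ.* b ℤ.- + 4 ℤ.* c)
                      ≡ (a ℤ.+ b) ℤ.- + 6 ℤ.* c
  collect = solve-∀

Z-recursion : ∀ {L i} → 2 ^ suc i ∣ L → 0 < L →
              ((tr L (Z L (suc i)) -B X (2 * L)) +B ((+ (2 ^ i + 1)) ·B Y (2 * L)))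
              ≈[ 2 * L ] Z (2 * L) (suc (suc i))
Z-recursion {L} {i} (divides m L≡m*2^[1+i]) L>0 J _ = begin
  (tr L (Z L (suc i)) J ℤ.- X (2 * L) J) ℤ.+ + (2 ^ i + 1) ℤ.* Y (2 * L) J
    ≡⟨ cong₂ (λ u v → (u ℤ.- X (2 * L) J) ℤ.+ v ℤ.* Y (2 * L) J) tr-Z (ℤₚ.pos-+ (2 ^ i) 1) ⟩
  (((a ℤ.+ b) ℤ.- + (2 ^ suc i + 2) ℤ.* c) ℤ.- X (2 * L) J) ℤ.+ (z ℤ.+ + 1) ℤ.* Y (2 * L) J
    ≡⟨ cong (λ u → (((a ℤ.+ b) ℤ.- u ℤ.* c) ℤ.- X (2 * L) J) ℤ.+ (z ℤ.+ + 1) ℤ.* Y (2 * L) J)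
            coefficient₁ ⟩
  (((a ℤ.+ b) ℤ.- (+ 2 ℤ.* z ℤ.+ + 2) ℤ.* c) ℤ.- ((b ℤ.- c) ℤ.- + 2 ℤ.* d))
    ℤ.+ (z ℤ.+ + 1) ℤ.* (+ 2 ℤ.* c ℤ.- + 4 ℤ.* d)
    ≡⟨ regroup a b c d z ⟩
  (a ℤ.+ c) ℤ.- (+ 2 ℤ.* (+ 2 ℤ.* z) ℤ.+ + 2) ℤ.* d
    ≡⟨ cong (λ u → (a ℤ.+ c) ℤ.- u ℤ.* d) coefficient₂ ⟨
  Z (2 * L) (suc (suc i)) J ∎
  where
  open ≡-Reasoning
  a b c d z : ℤ
  a = t (2 * L) (2 ^ suc (suc i)) J
  b = t (2 * L) 4 J
  c = t (2 * L) 2 J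
  d = t (2 * L) 1 J
  z = + (2 ^ i)
  L≡m*2^i*2 : L ≡ (m * 2 ^ i) * 2
  L≡m*2^i*2 = trans L≡m*2^[1+i] (trans (cong (m *_) (ℕₚ.*-comm 2 (2 ^ i))) (sym (ℕₚ.*-assoc m (2 ^ i) 2)))
  tr-Z : tr L (Z L (suc i)) J ≡ (a ℤ.+ b) ℤ.- + (2 ^ suc i + 2) ℤ.* c
  tr-Z = trans (Z-expand (tr-linear L J) L (suc i))
               (cong₂ (λ u v → u ℤ.- + (2 ^ suc i + 2) ℤ.* v)
                      (cong₂ ℤ._+_ (tr-t {m = m} {k = 2 ^ suc i} 2 J L≡m*2^[1+i] (s≤s z≤n) L>0)
                                   (tr-t {m = m * 2 ^ i} {k = 2} 2 J L≡m*2^i*2 (s≤s z≤n) L>0))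
                      (tr-t {m = L} {k = 1} 2 J (sym (ℕₚ.*-identityʳ L)) (s≤s z≤n) L>0))
  coefficient₁ : + (2 ^ suc i + 2) ≡ + 2 ℤ.* z ℤ.+ + 2
  coefficient₁ = trans (ℤₚ.pos-+ (2 ^ suc i) 2) (cong (ℤ._+ + 2) (ℤₚ.pos-* 2 (2 ^ i)))
  coefficient₂ : + (2 ^ suc (suc i) + 2) ≡ + 2 ℤ.* (+ 2 ℤ.* z) ℤ.+ + 2
  coefficient₂ = trans (ℤₚ.pos-+ (2 ^ suc (suc i)) 2)
                       (cong (ℤ._+ + 2) (trans (ℤₚ.pos-* 2 (2 ^ suc i))
                                               (cong (+ 2 ℤ.*_) (ℤₚ.pos-* 2 (2 ^ i)))))
  regroup : ∀ a b c d z →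
            (((a ℤ.+ b) ℤ.- (+ 2 ℤ.* z ℤ.+ + 2) ℤ.* c) ℤ.- ((b ℤ.- c) ℤ.- + 2 ℤ.* d))
              ℤ.+ (z ℤ.+ + 1) ℤ.* (+ 2 ℤ.* c ℤ.- + 4 ℤ.* d)
            ≡ (a ℤ.+ c) ℤ.- (+ 2 ℤ.* (+ 2 ℤ.* z) ℤ.+ + 2) ℤ.* d
  regroup = solve-∀

-- Closure properties of a Tambara ideal

module _ {N : ℕ} (N>0 : 0 < N) {I : ℕ → Bur → Set} (𝓘 : IsTambaraIdeal N I) where

  open IsTambaraIdeal 𝓘
  module Ideal {M} (M∣N : M ∣ N) = IsIdeal (ideal M M∣N)

  ·-closed : ∀ {M x} → M ∣ N → ∀ n → I M x → I M (n ·B x)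
  ·-closed {M} {x} M∣N (+ n)    x∈ = +-multiple n
    where
    open Ideal M∣N
    +-multiple : ∀ n → I M ((+ n) ·B x)
    +-multiple zero    = resp (λ _ _ → refl) has0
    +-multiple (suc n) = resp (λ J _ → step (x J) (+ n)) (+-cl x∈ (+-multiple n))
      where
      step : ∀ a n → a ℤ.+ n ℤ.* a ≡ (+ 1 ℤ.+ n) ℤ.* a
      step = solve-∀
  ·-closed {M} {x} M∣N -[1+ n ] x∈ =
    resp (λ J _ → ℤₚ.neg-distribˡ-* (+ suc n) (x J)) (neg-cl (·-closed M∣N (+ suc n) x∈))
    where open Ideal M∣N

  norm-step : ∀ {q L x T R} → Prime q → q * L ∣ N → I L x → I (q * L) R →
              IsNorm L (q * L) x (T -B R) → I (q * L) T
  norm-step {q} {L} {x} {T} {R} q-prime qL∣N x∈ R∈ T-R-isNorm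
    with norm-cl L (q * L) (n∣m*n q) qL∣N x∈ T-R-isNorm (isNorm-zero q-prime L>0)
    where
    L>0 : 0 < L
    L>0 = ∣-positive (∣-trans (n∣m*n q) qL∣N) N>0
  ... | w , w∈ , T-R≈w+0 = resp (λ J J∣qL → recover (T J) (R J) (w J) (T-R≈w+0 J J∣qL)) (+-cl w∈ R∈)
    where
    open Ideal qL∣N
    recover : ∀ a b c → a ℤ.- b ≡ c ℤ.+ + 0 → c ℤ.+ b ≡ a
    recover a b c a-b≡c+0 = begin
      c ℤ.+ b          ≡⟨ cong (ℤ._+ b) (trans (sym (ℤₚ.+-identityʳ c)) (sym a-b≡c+0)) ⟩
      (a ℤ.- b) ℤ.+ b  ≡⟨ cancel a b ⟩
      a                ∎
      where
      open ≡-Reasoning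
      cancel : ∀ a b → (a ℤ.- b) ℤ.+ b ≡ a
      cancel = solve-∀

  X-doubling : ∀ {L} → 4 ∣ L → 2 * L ∣ N → I L (X L) → I (2 * L) (X (2 * L))
  X-doubling {L} 4∣L 2L∣N x∈ =
    norm-step prime[2] 2L∣N x∈ (tr-cl L (2 * L) (n∣m*n 2) 2L∣N (·-closed L∣N (+ 2) x∈))
              (X-doubling-norm 4∣L (∣-positive L∣N N>0))
    where
    L∣N : L ∣ N
    L∣N = ∣-trans (n∣m*n 2) 2L∣N

  Y-doubling : ∀ {L} → 2 ∣ L → 2 * L ∣ N → I L (Y L) → I (2 * L) (Y (2 * L))
  Y-doubling {L} 2∣L 2L∣N y∈ =
    norm-step prime[2] 2L∣N y∈ (tr-cl L (2 * L) (n∣m*n 2) 2L∣N (·-closed L∣N (+ 2) y∈))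
              (Y-doubling-norm 2∣L (∣-positive L∣N N>0))
    where
    L∣N : L ∣ N
    L∣N = ∣-trans (n∣m*n 2) 2L∣N

  Y-half-from-X : ∀ {c} → c * 4 ∣ N → I (c * 4) (X (c * 4)) → I (c * 2) (Y (c * 2))
  Y-half-from-X {c} c*4∣N x∈ =
    Ideal.resp c*2∣N (res-X≈Y {c} (m*n>0⇒m>0 4 (∣-positive c*4∣N N>0)))
                     (res-cl (c * 2) (c * 4) c*2∣c*4 c*4∣N x∈)
    where
    c*2∣c*4 : c * 2 ∣ c * 4
    c*2∣c*4 = divides 2 (trans (sym (ℕₚ.*-assoc c 2 2)) (ℕₚ.*-comm (c * 2) 2))
    c*2∣N : c * 2 ∣ N
    c*2∣N = ∣-trans c*2∣c*4 c*4∣N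

  Y-from-X : ∀ {L} → 4 ∣ L → L ∣ N → I L (X L) → I L (Y L)
  Y-from-X {L} (divides c L≡c*4) L∣N x∈ = subst (λ M → I M (Y M)) 2*c*2≡L
    (Y-doubling (divides c refl) (subst (_∣ N) (sym 2*c*2≡L) L∣N)
                (Y-half-from-X {c} (subst (_∣ N) L≡c*4 L∣N) (subst (λ M → I M (X M)) L≡c*4 x∈)))
    where
    2*c*2≡L : 2 * (c * 2) ≡ L
    2*c*2≡L = trans (ℕₚ.*-comm 2 (c * 2)) (trans (ℕₚ.*-assoc c 2 2) (sym L≡c*4))

  X-odd-step : ∀ {p L} → Prime p → ¬ 2 ∣ p → 4 ∣ L → p * L ∣ N → I L (X L) → I (p * L) (X (p * L))
  X-odd-step {suc (suc k)} {L} p-prime p-odd 4∣L pL∣N x∈ =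
    norm-step p-prime pL∣N x∈ (tr-cl L (suc (suc k) * L) (n∣m*n (suc (suc k))) pL∣N z∈)
              (X-odd-norm 4∣L (∣-positive L∣N N>0))
    where
    open OddPrimeNorm {k} {proj₁ (fermat₂-odd p-prime p-odd)} p-prime p-odd (proj₂ (fermat₂-odd p-prime p-odd))
    L∣N : L ∣ N
    L∣N = ∣-trans (n∣m*n (suc (suc k))) pL∣N
    z∈ : I L ((α ·B X L) +B (β ·B Y L))
    z∈ = Ideal.+-cl L∣N (·-closed L∣N α x∈) (·-closed L∣N β (Y-from-X 4∣L L∣N x∈))

  X-prime-step : ∀ {p L} → Prime p → 4 ∣ L → p * L ∣ N → I L (X L) → I (p * L) (X (p * L))
  X-prime-step {p} p-prime 4∣L pL∣N x∈ with p ℕ.≟ 2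
  ... | yes refl = X-doubling 4∣L pL∣N x∈
  ... | no p≢2   = X-odd-step p-prime p-odd 4∣L pL∣N x∈
    where
    p-odd : ¬ 2 ∣ p
    p-odd 2∣p with prime⇒irreducible p-prime 2∣p
    ... | inj₁ ()
    ... | inj₂ 2≡p = p≢2 (sym 2≡p)

  X-along-primes : ∀ {K} → 4 ∣ K → I K (X K) → ∀ ps → All Prime ps →
                   K * product ps ∣ N → I (K * product ps) (X (K * product ps))
  X-along-primes {K} 4∣K x∈ []       []                _      =
    subst (λ M → I M (X M)) (sym (ℕₚ.*-identityʳ K)) x∈
  X-along-primes {K} 4∣K x∈ (p ∷ ps) (p-prime ∷ primes) K*pQ∣N =
    subst (λ M → I M (X M)) (sym K*pQ≡p*KQ)
          (X-prime-step p-prime (∣-trans 4∣K (m∣m*n (product ps))) (subst (_∣ N) K*pQ≡p*KQ K*pQ∣N)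
                        (X-along-primes 4∣K x∈ ps primes (∣-trans (*-monoʳ-∣ K (n∣m*n p)) K*pQ∣N)))
    where
    K*pQ≡p*KQ : K * (p * product ps) ≡ p * (K * product ps)
    K*pQ≡p*KQ = x∙yz≈y∙xz K p (product ps)

  X-multiple : ∀ {K} → 4 ∣ K → I K (X K) → ∀ {L} → K ∣ L → L ∣ N → I L (X L)
  X-multiple {K} 4∣K x∈ {L} (divides n L≡n*K) L∣N =
    subst (λ M → I M (X M)) (sym L≡K*Πps)
          (X-along-primes 4∣K x∈ (factors fn) (factorsPrime fn) (subst (_∣ N) L≡K*Πps L∣N))
    where
    open PrimeFactorisation using (factors; isFactorisation; factorsPrime)
    n>0 : 0 < n
    n>0 = m*n>0⇒m>0 K (subst (0 <_) L≡n*K (∣-positive L∣N N>0))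
    fn : PrimeFactorisation n
    fn = factorise n ⦃ ℕ.>-nonZero n>0 ⦄
    L≡K*Πps : L ≡ K * product (factors fn)
    L≡K*Πps = trans L≡n*K (trans (ℕₚ.*-comm n K) (cong (K *_) (isFactorisation fn)))

  Z-member : ∀ {K} → 4 ∣ K → I K (X K) → ∀ n {L} → K * 2 ^ n ∣ L → L ∣ N → I L (Z L (2 + n))
  Z-member {K} 4∣K x∈ zero {L} K*1∣L L∣N =
    Ideal.resp L∣N (X+Y≈Z₂ L) (Ideal.+-cl L∣N x∈L (Y-from-X (∣-trans 4∣K K∣L) L∣N x∈L))
    where
    K∣L : K ∣ L
    K∣L = ∣-trans (m∣m*n 1) K*1∣L
    x∈L : I L (X L)
    x∈L = X-multiple 4∣K x∈ K∣L L∣N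
  Z-member {K} 4∣K x∈ (suc n) {L} (divides m L≡m*[K*2^[1+n]]) L∣N =
    subst (λ M → I M (Z M (3 + n))) (sym L≡2*L′)
      (Ideal.resp 2L′∣N (Z-recursion {L′} {suc n} 2^[2+n]∣L′ (∣-positive L′∣N N>0))
        (Ideal.+-cl 2L′∣N
          (Ideal.+-cl 2L′∣N
            (tr-cl L′ (2 * L′) (n∣m*n 2) 2L′∣N (Z-member 4∣K x∈ n (divides m refl) L′∣N))
            (Ideal.neg-cl 2L′∣N x∈2L′))
          (·-closed 2L′∣N (+ (2 ^ suc n + 1)) (Y-from-X (∣-trans 4∣K K∣2L′) 2L′∣N x∈2L′))))
    where
    L′ : ℕ
    L′ = m * (K * 2 ^ n)
    L≡2*L′ : L ≡ 2 * L′
    L≡2*L′ = trans L≡m*[K*2^[1+n]]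
                   (trans (cong (m *_) (x∙yz≈y∙xz K 2 (2 ^ n))) (x∙yz≈y∙xz m 2 (K * 2 ^ n)))
    2L′∣N : 2 * L′ ∣ N
    2L′∣N = subst (_∣ N) L≡2*L′ L∣N
    L′∣N : L′ ∣ N
    L′∣N = ∣-trans (n∣m*n 2) 2L′∣N
    K∣2L′ : K ∣ 2 * L′
    K∣2L′ = ∣-trans (m∣m*n (2 ^ n)) (∣-trans (n∣m*n m) (n∣m*n 2))
    2^[2+n]∣L′ : 2 ^ (2 + n) ∣ L′
    2^[2+n]∣L′ = ∣-trans (subst (_∣ K * 2 ^ n) (ℕₚ.*-assoc 2 2 (2 ^ n)) (*-monoˡ-∣ (2 ^ n) 4∣K))
                         (n∣m*n m)
    x∈2L′ : I (2 * L′) (X (2 * L′))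
    x∈2L′ = X-multiple 4∣K x∈ K∣2L′ 2L′∣N

lemma3p7 : (N : ℕ) → 0 < N → (I : ℕ → Bur → Set) → IsTambaraIdeal N I →
    (K M : ℕ) → K ∣ M → M ∣ N → 4 ∣ K →
    I K ((t K 4 -B t K 2) -B ι K (+ 2)) →
    (j : ℕ) → 2 ^ j ∣ (M div K) → ¬ (2 ^ suc j ∣ (M div K)) →
    ((i : ℕ) → 1 ≤ i → i ≤ j + 2 →
       I M ((t M (2 ^ i) +B t M 2) -B ι M (+ (2 ^ i + 2))))
    × I (K div 2) (((+ 2) ·B t (K div 2) 2) -B ι (K div 2) (+ 4))
lemma3p7 N N>0 I 𝓘 K M K∣M M∣N 4∣K@(divides c K≡c*4) x∈ j 2^j∣M/K _ = Z-members , Y-member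
  where
  K*2^j∣M : K * 2 ^ j ∣ M
  K*2^j∣M = d∣n/m⇒m*d∣n K∣M (∣-positive M∣N N>0) 2^j∣M/K
  Z-members : ∀ i → 1 ≤ i → i ≤ j + 2 → I M (Z M i)
  Z-members (suc zero)    _ _         =
    IsIdeal.resp (IsTambaraIdeal.ideal 𝓘 M M∣N) (λ J J∣M → sym (Z₁≈Y M J J∣M))
                 (Y-from-X N>0 𝓘 (∣-trans 4∣K K∣M) M∣N (X-multiple N>0 𝓘 4∣K x∈ K∣M M∣N))
  Z-members (suc (suc n)) _ 2+n≤j+2 =
    Z-member N>0 𝓘 4∣K x∈ n (∣-trans (*-monoʳ-∣ K (^-monoʳ-∣ 2 n≤j)) K*2^j∣M) M∣N
    where
    n≤j : n ≤ j
    n≤j = ℕₚ.+-cancelˡ-≤ 2 n j (subst (2 + n ≤_) (ℕₚ.+-comm j 2) 2+n≤j+2)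
  Y-member : I (K div 2) (Y (K div 2))
  Y-member = subst (λ L → I L (Y L)) (sym (exact-div (trans K≡c*4 (sym (ℕₚ.*-assoc c 2 2))) (s≤s z≤n)))
                   (Y-half-from-X N>0 𝓘 {c} (subst (_∣ N) K≡c*4 (∣-trans K∣M M∣N))
                                             (subst (λ L → I L (X L)) K≡c*4 x∈))
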